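{- Let $p$ be an odd prime and let $G\cong\mathbb{Z}_p\oplus S_2$, where $S_2\cong(\mathbb{Z}_4)^\alpha\oplus(\mathbb{Z}_2)^\beta$ for some integers $\alpha,\beta\geq 0$ with $\alpha+\beta\geq 2$. Then there exists an MRS$^*_G(p,4;|G|/(4p))$.
   Context: $\mathbb{Z}_v$ denotes the additive group of integers modulo $v$; $K^\alpha$ denotes the direct sum of $\alpha$ copies of $K$ ($K^0$ trivial). For a finite abelian group $(G,+)$ of order $xyz$, an MRS$^*_G(x,y;z)$ is a collection of $z$ arrays of size $x\times y$ whose entries are elements of $G$, each element of $G$ appearing exactly once among all the arrays, such that every row sum and every column sum in every array equals $0$. -}

module Defs where

open import Level using (Level)
open import Data.Nat using (ℕ; zero; suc; _+_; _*_; _^_)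
open import Data.Nat.DivMod using (_mod_)
open import Data.Fin using (Fin; toℕ)
open import Data.Vec using (Vec; zipWith)
open import Data.Product using (_×_; _,_; Σ)
open import Relation.Binary.PropositionalEquality using (_≡_)
open import Algebra.Bundles using (AbelianGroup)

_+[mod]_ : ∀ {n} → Fin n → Fin n → Fin n
_+[mod]_ {suc n} a b = (toℕ a + toℕ b) mod (suc n)

ZpS2 : ℕ → ℕ → ℕ → Set
ZpS2 p α β = Fin p × Vec (Fin 4) α × Vec (Fin 2) β

_⊕_ : ∀ {p α β} → ZpS2 p α β → ZpS2 p α β → ZpS2 p α β
(a , u , v) ⊕ (a' , u' , v') = (a +[mod] a') , zipWith _+[mod]_ u u' , zipWith _+[mod]_ v v'

record IsoToZpS2 {c ℓ} (G : AbelianGroup c ℓ) (p α β : ℕ) : Set (c Level.⊔ ℓ) where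
  open AbelianGroup G
  field
    φ          : ZpS2 p α β → Carrier
    homo       : ∀ a b → φ (a ⊕ b) ≈ (φ a ∙ φ b)
    injective  : ∀ a b → φ a ≈ φ b → a ≡ b
    surjective : ∀ g → Σ (ZpS2 p α β) (λ a → φ a ≈ g)

module _ {c ℓ} (G : AbelianGroup c ℓ) where
  open AbelianGroup G

  ΣG : (n : ℕ) → (Fin n → Carrier) → Carrier
  ΣG zero    f = ε
  ΣG (suc n) f = f Fin.zero ∙ ΣG n (λ i → f (Fin.suc i))

  record MRS* (x y z : ℕ) : Set (c Level.⊔ ℓ) where
    field
      A          : Fin z → Fin x → Fin y → Carrier
      once-inj   : ∀ k i j k' i' j' → A k i j ≈ A k' i' j' → (k , i , j) ≡ (k' , i' , j')
      once-surj  : ∀ g → Σ (Fin z × Fin x × Fin y) (λ { (k , i , j) → A k i j ≈ g })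
      row-sums   : ∀ k i → ΣG y (λ j → A k i j) ≈ ε
      col-sums   : ∀ k j → ΣG x (λ i → A k i j) ≈ ε

-- Write p = 2N + 1 and S = ℤ₄^α ⊕ ℤ₂^β, and read ℤₚ as the signed numbers 0, ±1, …, ±N.
-- A core for S with parameter e consists of (2e + 1) × 4 arrays over {0, ±1, …, ±e} × S using
-- every element once, whose rows and columns sum to zero in S and, in the first coordinate,
-- already in ℤ; together with a partition of S into zero-sum quadruples. A core yields an MRS
-- for every odd p ≥ 2e + 1: the values ±(e + 1), …, ±N fill pairs of rows built from the
-- quadruples with column signs (+ + − −), and the two rows of a pair cancel in every column.
-- Explicit cores with e = 1 cover S of rank two or three, except S = ℤ₂² and ℤ₂³, which use
-- cores with e = 2 and explicit arrays for p = 3. Every other S is reached by adding factors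
-- T × T with T = ℤ₄ or ℤ₂: each cell is paired with every w ∈ T × T, its new coordinate in
-- row i and column j being ±Xᵢ w, where X₀, X₁, X₂ = 1, θ, θ² for θ (x , y) = (y , − x − y)
-- and the remaining rows come in pairs X = ±1; rows cancel by the column signs and columns
-- because 1 + θ + θ² = 0.

module Submission where

open import Defs
open import Level using (0ℓ; _⊔_)
open import Algebra.Bundles using (AbelianGroup)
open import Algebra.Core using (Op₁; Op₂)
open import Algebra.Definitions using (Associative; Commutative; LeftIdentity; RightInverse)
import Algebra.Properties.AbelianGroup as AbelianGroupProperties
import Algebra.Properties.CommutativeSemigroup as CommutativeSemigroupProperties
open import Algebra.Structures using (IsAbelianGroup)
open import Data.Fin using (Fin; zero; suc; toℕ; _↑ˡ_; _↑ʳ_; splitAt; join; combine; cast; opposite)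
open import Data.Fin.Patterns using (0F; 1F; 2F; 3F)
open import Data.Fin.Permutation using (↔⇒≡)
open import Data.Fin.Properties
  using (toℕ-injective; toℕ-fromℕ<; toℕ<n; toℕ-cast; toℕ-↑ˡ; toℕ-↑ʳ; cast-involutive;
         opposite-prop; opposite-involutive; splitAt-↑ˡ; splitAt-↑ʳ; splitAt-join; join-splitAt;
         +↔⊎; *↔×)
import Data.Fin.Properties as Fin
open import Data.Maybe using (Maybe; just)
import Data.Maybe as Maybe
open import Data.Maybe.Properties using (just-injective)
import Data.Maybe.Properties as Maybe
open import Data.Nat using (ℕ; zero; suc; _+_; _*_; _∸_; _^_; _≥_; s≤s; z≤n; NonZero)
import Data.Nat as ℕ
open import Data.Nat.Divisibility using (divides)
open import Data.Nat.DivMod using (_%_; _mod_; %-distribˡ-+; m<n⇒m%n≡m; n%n≡0; m%n<n)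
open import Data.Nat.Primality using (Prime; prime⇒irreducible; ¬prime[1])
open import Data.Nat.Properties
  using (+-assoc; +-comm; *-comm; *-assoc; +-suc; +-∸-assoc; m+[n∸m]≡n; <⇒≤; +-0-monoid)
open import Data.Nat.Tactic.RingSolver using (solve-∀)
open import Algebra.Properties.Monoid.Sum +-0-monoid using (sum; sum-cong-≗)
open import Data.Product using (Σ; _×_; _,_; ∃; ∃-syntax; proj₁; proj₂)
open import Data.Product.Function.NonDependent.Propositional using (_×-↔_)
import Data.Product.Properties as Product
open import Data.Sign as Sign using (Sign)
import Data.Sign.Properties as Sign
open import Data.Sum as Sum using (_⊎_; inj₁; inj₂; [_,_]′)
open import Data.Sum.Function.Propositional using (_⊎-↔_)
open import Data.Vec using (Vec; []; _∷_; zipWith; replicate; map; lookup)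
open import Data.Vec.Properties using (zipWith-assoc; zipWith-comm; zipWith-identityˡ; zipWith-inverseʳ)
import Data.Vec.Properties as Vec
open import Function using (_∘_; _↔_; Inverse; Injection; mk↔ₛ′)
open import Function.Properties.Inverse using (↔-refl; ↔-sym; ↔-trans; ↔⇒↣)
open import Relation.Binary.Definitions using (DecidableEquality)
open import Relation.Binary.PropositionalEquality
  using (_≡_; _≢_; refl; sym; trans; cong; cong₂; isEquivalence; module ≡-Reasoning)
open import Relation.Nullary.Decidable
  using (Dec; yes; no; map′; True; toWitness; dec⇒maybe; _×-dec_; _⊎-dec_; _→-dec_)
open import Relation.Nullary.Negation using (contradiction)
open import Relation.Unary using (Pred; Decidable)

open Inverse using (to; from; strictlyInverseˡ; strictlyInverseʳ)

-- The arrays are built over concrete groups with _≡_ as equality and transported to the given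
-- group G only at the end; `abelianGroup` is the view that `MRS*` expects.
record ≡-AbelianGroup : Set₁ where
  infixl 7 _∙_
  infix  8 _⁻¹
  infixr 8 _·_
  field
    Carrier        : Set
    _∙_            : Op₂ Carrier
    ε              : Carrier
    _⁻¹            : Op₁ Carrier
    isAbelianGroup : IsAbelianGroup _≡_ _∙_ ε _⁻¹

  abelianGroup : AbelianGroup 0ℓ 0ℓ
  abelianGroup = record { isAbelianGroup = isAbelianGroup }

  open AbelianGroup abelianGroup public using (assoc; comm; identityˡ; identityʳ; inverseʳ)
  open AbelianGroupProperties abelianGroup public using (⁻¹-involutive; ε⁻¹≈ε; ⁻¹-∙-comm)

  _·_ : Sign → Carrier → Carrier
  Sign.+ · x = x
  Sign.- · x = x ⁻¹

  ·-homo : ∀ s x y → s · (x ∙ y) ≡ s · x ∙ s · y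
  ·-homo Sign.+ x y = refl
  ·-homo Sign.- x y = sym (⁻¹-∙-comm x y)

  ·-ε : ∀ s → s · ε ≡ ε
  ·-ε Sign.+ = refl
  ·-ε Sign.- = ε⁻¹≈ε

  ·-* : ∀ s t x → (s Sign.* t) · x ≡ s · t · x
  ·-* Sign.+ t      x = refl
  ·-* Sign.- Sign.+ x = refl
  ·-* Sign.- Sign.- x = sym (⁻¹-involutive x)

  ·-involutive : ∀ s x → s · s · x ≡ x
  ·-involutive Sign.+ x = refl
  ·-involutive Sign.- x = ⁻¹-involutive x

  ·↔ : Sign → Carrier ↔ Carrier
  ·↔ s = mk↔ₛ′ (s ·_) (s ·_) (·-involutive s) (·-involutive s)

≡-isAbelianGroup : {A : Set} {_∙_ : Op₂ A} {ε : A} {_⁻¹ : Op₁ A} →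
                   Associative _≡_ _∙_ → Commutative _≡_ _∙_ →
                   LeftIdentity _≡_ ε _∙_ → RightInverse _≡_ ε _⁻¹ _∙_ →
                   IsAbelianGroup _≡_ _∙_ ε _⁻¹
≡-isAbelianGroup {_∙_ = _∙_} {ε} {_⁻¹} assoc comm identityˡ inverseʳ = record
  { isGroup = record
    { isMonoid = record
      { isSemigroup = record
        { isMagma = record { isEquivalence = isEquivalence ; ∙-cong = cong₂ _∙_ }
        ; assoc   = assoc
        }
      ; identity = identityˡ , λ x → trans (comm x ε) (identityˡ x)
      }
    ; inverse = (λ x → trans (comm (x ⁻¹) x) (inverseʳ x)) , inverseʳ
    ; ⁻¹-cong = cong _⁻¹
    }
  ; comm = comm
  }

module _ {m : ℕ} .{{_ : NonZero m}} where

  toℕ-mod : ∀ k → toℕ (k mod m) ≡ k % m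
  toℕ-mod k = toℕ-fromℕ< (m%n<n k m)

  toℕ-mod-inverse : ∀ (a : Fin m) → toℕ a mod m ≡ a
  toℕ-mod-inverse a = toℕ-injective (trans (toℕ-mod (toℕ a)) (m<n⇒m%n≡m (toℕ<n a)))

module _ {n : ℕ} where

  private
    m : ℕ
    m = suc n

  n-mod-n : m mod m ≡ zero
  n-mod-n = toℕ-injective (trans (toℕ-mod m) (n%n≡0 m))

  mod-distrib-+ : ∀ x y → (x + y) mod m ≡ (x mod m) +[mod] (y mod m)
  mod-distrib-+ x y = toℕ-injective (begin
    toℕ ((x + y) mod m)                  ≡⟨ toℕ-mod (x + y) ⟩
    (x + y) % m                          ≡⟨ %-distribˡ-+ x y m ⟩
    (x % m + y % m) % m                  ≡⟨ cong₂ (λ a b → (a + b) % m) (toℕ-mod x) (toℕ-mod y) ⟨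
    (toℕ (x mod m) + toℕ (y mod m)) % m  ≡⟨ toℕ-mod (toℕ (x mod m) + toℕ (y mod m)) ⟨
    toℕ ((x mod m) +[mod] (y mod m))     ∎)
    where open ≡-Reasoning

  +[mod]-assoc : Associative _≡_ (_+[mod]_ {m})
  +[mod]-assoc a b c = begin
    ((toℕ a + toℕ b) mod m) +[mod] c                ≡⟨ cong (((toℕ a + toℕ b) mod m) +[mod]_) (toℕ-mod-inverse c) ⟨
    ((toℕ a + toℕ b) mod m) +[mod] (toℕ c mod m)    ≡⟨ mod-distrib-+ (toℕ a + toℕ b) (toℕ c) ⟨
    (toℕ a + toℕ b + toℕ c) mod m                   ≡⟨ cong (_mod m) (+-assoc (toℕ a) (toℕ b) (toℕ c)) ⟩
    (toℕ a + (toℕ b + toℕ c)) mod m                 ≡⟨ mod-distrib-+ (toℕ a) (toℕ b + toℕ c) ⟩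
    (toℕ a mod m) +[mod] ((toℕ b + toℕ c) mod m)    ≡⟨ cong (_+[mod] (b +[mod] c)) (toℕ-mod-inverse a) ⟩
    a +[mod] (b +[mod] c)                           ∎
    where open ≡-Reasoning

  +[mod]-comm : Commutative _≡_ (_+[mod]_ {m})
  +[mod]-comm a b = cong (_mod m) (+-comm (toℕ a) (toℕ b))

  +[mod]-identityˡ : LeftIdentity _≡_ zero (_+[mod]_ {m})
  +[mod]-identityˡ = toℕ-mod-inverse

  -[mod]_ : Fin m → Fin m
  -[mod] a = (m ∸ toℕ a) mod m

  +[mod]-inverseʳ : RightInverse _≡_ zero -[mod]_ (_+[mod]_ {m})
  +[mod]-inverseʳ a = begin
    a +[mod] ((m ∸ toℕ a) mod m)                 ≡⟨ cong (_+[mod] ((m ∸ toℕ a) mod m)) (toℕ-mod-inverse a) ⟨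
    (toℕ a mod m) +[mod] ((m ∸ toℕ a) mod m)     ≡⟨ mod-distrib-+ (toℕ a) (m ∸ toℕ a) ⟨
    (toℕ a + (m ∸ toℕ a)) mod m                  ≡⟨ cong (_mod m) (m+[n∸m]≡n (<⇒≤ (toℕ<n a))) ⟩
    m mod m                                      ≡⟨ n-mod-n ⟩
    zero                                         ∎
    where open ≡-Reasoning

ℤ/_ : (m : ℕ) → .{{NonZero m}} → ≡-AbelianGroup
ℤ/ suc n = record
  { Carrier        = Fin (suc n)
  ; _∙_            = _+[mod]_
  ; ε              = zero
  ; _⁻¹            = -[mod]_
  ; isAbelianGroup = ≡-isAbelianGroup +[mod]-assoc +[mod]-comm +[mod]-identityˡ +[mod]-inverseʳ
  }

Vecᴳ : ≡-AbelianGroup → ℕ → ≡-AbelianGroup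
Vecᴳ G n = record
  { Carrier        = Vec Carrier n
  ; _∙_            = zipWith _∙_
  ; ε              = replicate n ε
  ; _⁻¹            = map _⁻¹
  ; isAbelianGroup = ≡-isAbelianGroup
      (zipWith-assoc assoc) (zipWith-comm comm) (zipWith-identityˡ identityˡ) (zipWith-inverseʳ inverseʳ)
  }
  where open ≡-AbelianGroup G

infixr 5 _×ᴳ_
_×ᴳ_ : ≡-AbelianGroup → ≡-AbelianGroup → ≡-AbelianGroup
G ×ᴳ H = record
  { Carrier        = G.Carrier × H.Carrier
  ; _∙_            = λ (x , y) (x′ , y′) → x G.∙ x′ , y H.∙ y′
  ; ε              = G.ε , H.ε
  ; _⁻¹            = λ (x , y) → x G.⁻¹ , y H.⁻¹
  ; isAbelianGroup = ≡-isAbelianGroup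
      (λ _ _ _ → cong₂ _,_ (G.assoc _ _ _) (H.assoc _ _ _))
      (λ _ _ → cong₂ _,_ (G.comm _ _) (H.comm _ _))
      (λ _ → cong₂ _,_ (G.identityˡ _) (H.identityˡ _))
      (λ _ → cong₂ _,_ (G.inverseʳ _) (H.inverseʳ _))
  }
  where
    module G = ≡-AbelianGroup G
    module H = ≡-AbelianGroup H

S₂ᴳ : ℕ → ℕ → ≡-AbelianGroup
S₂ᴳ α β = Vecᴳ (ℤ/ 4) α ×ᴳ Vecᴳ (ℤ/ 2) β

ZpS2ᴳ : (p : ℕ) → .{{NonZero p}} → ℕ → ℕ → ≡-AbelianGroup
ZpS2ᴳ p α β = ℤ/ p ×ᴳ S₂ᴳ α β

pairedRows↔ : ∀ c h → Fin (c + h * 2) ↔ (Fin c ⊎ (Fin h × Sign))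
pairedRows↔ c h = ↔-trans (+↔⊎ {c}) (↔-refl ⊎-↔ ↔-trans (*↔× {h}) (↔-refl ×-↔ Fin2↔Sign))
  where
    Fin2↔Sign : Fin 2 ↔ Sign
    Fin2↔Sign = mk↔ₛ′ (λ { 0F → Sign.+ ; 1F → Sign.- }) (λ { Sign.+ → 0F ; Sign.- → 1F })
                      (λ { Sign.+ → refl ; Sign.- → refl }) (λ { 0F → refl ; 1F → refl })

module _ {a ℓ} (G : AbelianGroup a ℓ) where

  open AbelianGroup G
    using (Carrier; _≈_; _∙_; ε; ∙-cong; ∙-congˡ; identityˡ; identityʳ; assoc; reflexive; commutativeSemigroup)
    renaming (refl to ≈-refl; sym to ≈-sym; trans to ≈-trans)
  open CommutativeSemigroupProperties commutativeSemigroup using (interchange)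

  ΣG-cong : ∀ n {f g : Fin n → Carrier} → (∀ i → f i ≈ g i) → ΣG G n f ≈ ΣG G n g
  ΣG-cong zero    f≈g = ≈-refl
  ΣG-cong (suc n) f≈g = ∙-cong (f≈g zero) (ΣG-cong n (f≈g ∘ suc))

  ΣG-ε : ∀ n → ΣG G n (λ _ → ε) ≈ ε
  ΣG-ε zero    = ≈-refl
  ΣG-ε (suc n) = ≈-trans (identityˡ _) (ΣG-ε n)

  ΣG-∙ : ∀ n (f g : Fin n → Carrier) → ΣG G n (λ i → f i ∙ g i) ≈ ΣG G n f ∙ ΣG G n g
  ΣG-∙ zero    f g = ≈-sym (identityˡ ε)
  ΣG-∙ (suc n) f g = ≈-trans (∙-congˡ (ΣG-∙ n (f ∘ suc) (g ∘ suc))) (interchange _ _ _ _)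

  ΣG-++ : ∀ m n (f : Fin (m + n) → Carrier) →
          ΣG G (m + n) f ≈ ΣG G m (f ∘ (_↑ˡ n)) ∙ ΣG G n (f ∘ (m ↑ʳ_))
  ΣG-++ zero    n f = ≈-sym (identityˡ _)
  ΣG-++ (suc m) n f = ≈-trans (∙-congˡ (ΣG-++ m n (f ∘ suc))) (≈-sym (assoc _ _ _))

  ΣG-* : ∀ m n (f : Fin (m * n) → Carrier) →
         ΣG G (m * n) f ≈ ΣG G m (λ i → ΣG G n (λ j → f (combine i j)))
  ΣG-* zero    n f = ≈-refl
  ΣG-* (suc m) n f = ≈-trans (ΣG-++ n (m * n) f) (∙-congˡ (ΣG-* m n (f ∘ (n ↑ʳ_))))

  ΣG-pairedRows : ∀ c h (f : Fin c ⊎ (Fin h × Sign) → Carrier) →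
                  ΣG G (c + h * 2) (f ∘ to (pairedRows↔ c h)) ≈
                  ΣG G c (f ∘ inj₁) ∙ ΣG G h (λ m → f (inj₂ (m , Sign.+)) ∙ f (inj₂ (m , Sign.-)))
  ΣG-pairedRows c h f = ≈-trans (ΣG-++ c (h * 2) _) (∙-cong
    (ΣG-cong c λ r → reflexive (cong f (strictlyInverseˡ P (inj₁ r))))
    (≈-trans (ΣG-* h 2 _) (ΣG-cong h λ m →
      ∙-cong (reflexive (cong f (strictlyInverseˡ P (inj₂ (m , Sign.+)))))
             (≈-trans (identityʳ _) (reflexive (cong f (strictlyInverseˡ P (inj₂ (m , Sign.-)))))))))
    where
      P : Fin (c + h * 2) ↔ (Fin c ⊎ (Fin h × Sign))
      P = pairedRows↔ c h

module _ {c ℓ} (H : ≡-AbelianGroup) (G : AbelianGroup c ℓ) (φ : ≡-AbelianGroup.Carrier H → AbelianGroup.Carrier G)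
         (homo : ∀ x y → AbelianGroup._≈_ G (φ (≡-AbelianGroup._∙_ H x y)) (AbelianGroup._∙_ G (φ x) (φ y))) where

  private
    module H = ≡-AbelianGroup H
  open AbelianGroup G using (_≈_; ε; ∙-congˡ; reflexive) renaming (sym to ≈-sym; trans to ≈-trans)
  open AbelianGroupProperties G using (identityʳ-unique)

  ε-homo : φ H.ε ≈ ε
  ε-homo = identityʳ-unique (φ H.ε) (φ H.ε)
             (≈-trans (≈-sym (homo H.ε H.ε)) (reflexive (cong φ (H.identityˡ H.ε))))

  ΣG-homo : ∀ n f → φ (ΣG H.abelianGroup n f) ≈ ΣG G n (φ ∘ f)
  ΣG-homo zero    f = ε-homo
  ΣG-homo (suc n) f = ≈-trans (homo _ _) (∙-congˡ (ΣG-homo n (f ∘ suc)))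

module _ (H : ≡-AbelianGroup) where

  open ≡-AbelianGroup H

  ZeroSum : ∀ {n} → (Fin n → Carrier) → Set
  ZeroSum {n} f = ΣG abelianGroup n f ≡ ε

  ΣG-· : ∀ s n (f : Fin n → Carrier) → s · ΣG abelianGroup n f ≡ ΣG abelianGroup n (λ i → s · f i)
  ΣG-· s = ΣG-homo H abelianGroup (s ·_) (·-homo s)

  ZeroSum-· : ∀ s {n} (f : Fin n → Carrier) → ZeroSum f → ZeroSum (λ i → s · f i)
  ZeroSum-· s f zero-sum = trans (sym (ΣG-· s _ f)) (trans (cong (s ·_) zero-sum) (·-ε s))

module _ (G H : ≡-AbelianGroup) where

  private
    module G = ≡-AbelianGroup G
    module H = ≡-AbelianGroup H

  ΣG-× : ∀ n (f : Fin n → G.Carrier × H.Carrier) →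
         ΣG (≡-AbelianGroup.abelianGroup (G ×ᴳ H)) n f ≡
         (ΣG G.abelianGroup n (proj₁ ∘ f) , ΣG H.abelianGroup n (proj₂ ∘ f))
  ΣG-× zero    f = refl
  ΣG-× (suc n) f = cong (≡-AbelianGroup._∙_ (G ×ᴳ H) (f zero)) (ΣG-× n (f ∘ suc))

columnSign : Fin 4 → Sign
columnSign 0F = Sign.+
columnSign 1F = Sign.+
columnSign 2F = Sign.-
columnSign 3F = Sign.-

ZeroSum-columnSign : ∀ H x → ZeroSum H (λ j → ≡-AbelianGroup._·_ H (columnSign j) x)
ZeroSum-columnSign H x = begin
  x ∙ (x ∙ (x ⁻¹ ∙ (x ⁻¹ ∙ ε)))  ≡⟨ cong (λ y → x ∙ (x ∙ (x ⁻¹ ∙ y))) (identityʳ (x ⁻¹)) ⟩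
  x ∙ (x ∙ (x ⁻¹ ∙ x ⁻¹))        ≡⟨ cong (x ∙_) (assoc x (x ⁻¹) (x ⁻¹)) ⟨
  x ∙ (x ∙ x ⁻¹ ∙ x ⁻¹)          ≡⟨ cong (λ y → x ∙ (y ∙ x ⁻¹)) (inverseʳ x) ⟩
  x ∙ (ε ∙ x ⁻¹)                 ≡⟨ cong (x ∙_) (identityˡ (x ⁻¹)) ⟩
  x ∙ x ⁻¹                       ≡⟨ inverseʳ x ⟩
  ε                              ∎
  where
    open ≡-Reasoning
    open ≡-AbelianGroup H

Cell : ℕ → ℕ → ℕ → Set
Cell x y z = Fin z × Fin x × Fin y

module _ (H : ≡-AbelianGroup) where

  open ≡-AbelianGroup H

  mrs*-from-↔ : ∀ {x y z} (cell↔ : Cell x y z ↔ Carrier) →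
                (∀ k i → ZeroSum H (λ j → to cell↔ (k , i , j))) →
                (∀ k j → ZeroSum H (λ i → to cell↔ (k , i , j))) →
                MRS* abelianGroup x y z
  mrs*-from-↔ cell↔ row-sums col-sums = record
    { A         = λ k i j → to cell↔ (k , i , j)
    ; once-inj  = λ _ _ _ _ _ _ → Injection.injective (↔⇒↣ cell↔)
    ; once-surj = λ g → from cell↔ g , strictlyInverseˡ cell↔ g
    ; row-sums  = row-sums
    ; col-sums  = col-sums
    }

  cell↔ : ∀ {x y z} → MRS* abelianGroup x y z → Cell x y z ↔ Carrier
  cell↔ M = mk↔ₛ′ (λ (k , i , j) → A k i j) (proj₁ ∘ once-surj) (proj₂ ∘ once-surj)
                  (λ (k , i , j) → sym (once-inj k i j _ _ _ (sym (proj₂ (once-surj (A k i j))))))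
    where open MRS* M

  mrs*-size : ∀ {x y z N} → Fin N ↔ Carrier → MRS* abelianGroup x y z → z * (x * y) ≡ N
  mrs*-size enum M = ↔⇒≡ (↔-trans (↔-trans *↔× (↔-refl ×-↔ *↔×)) (↔-trans (cell↔ M) (↔-sym enum)))

infix 4 _≅_
record _≅_ {c ℓ} (H : ≡-AbelianGroup) (G : AbelianGroup c ℓ) : Set (c ⊔ ℓ) where
  private
    module H = ≡-AbelianGroup H
  open AbelianGroup G
  field
    φ          : H.Carrier → Carrier
    homo       : ∀ a b → φ (a H.∙ b) ≈ φ a ∙ φ b
    injective  : ∀ a b → φ a ≈ φ b → a ≡ b
    surjective : ∀ g → Σ H.Carrier (λ a → φ a ≈ g)

≅-from-↔ : (H H′ : ≡-AbelianGroup) (e : ≡-AbelianGroup.Carrier H ↔ ≡-AbelianGroup.Carrier H′) →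
           (∀ a b → to e (≡-AbelianGroup._∙_ H a b) ≡ ≡-AbelianGroup._∙_ H′ (to e a) (to e b)) →
           H ≅ ≡-AbelianGroup.abelianGroup H′
≅-from-↔ H H′ e homo = record
  { φ          = to e
  ; homo       = homo
  ; injective  = λ _ _ → Injection.injective (↔⇒↣ e)
  ; surjective = λ g → from e g , strictlyInverseˡ e g
  }

module _ {c ℓ} {H : ≡-AbelianGroup} {G : AbelianGroup c ℓ} (iso : H ≅ G) where

  private
    module H = ≡-AbelianGroup H
  open AbelianGroup G using (_≈_; ε; reflexive) renaming (sym to ≈-sym; trans to ≈-trans)
  open _≅_ iso

  mrs*-transport : ∀ {x y z} → MRS* H.abelianGroup x y z → MRS* G x y z
  mrs*-transport M = record
    { A         = λ k i j → φ (A k i j)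
    ; once-inj  = λ k i j k′ i′ j′ φA≈φA′ → once-inj k i j k′ i′ j′ (injective _ _ φA≈φA′)
    ; once-surj = λ g → let a , φa≈g = surjective g ; c , Ac≡a = once-surj a
                        in c , ≈-trans (reflexive (cong φ Ac≡a)) φa≈g
    ; row-sums  = λ k i → zero-sum (A k i) (row-sums k i)
    ; col-sums  = λ k j → zero-sum (λ i → A k i j) (col-sums k j)
    }
    where
      open MRS* M
      zero-sum : ∀ {n} (f : Fin n → H.Carrier) → ZeroSum H f → ΣG G n (φ ∘ f) ≈ ε
      zero-sum {n} f Σf≡ε =
        ≈-trans (≈-sym (ΣG-homo H G φ homo n f)) (≈-trans (reflexive (cong φ Σf≡ε)) (ε-homo H G φ homo))

-- Signed numbers and their residues

-- `signed s i` stands for the integer s (1 + i).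
data SignedFin (n : ℕ) : Set where
  0ₛ     : SignedFin n
  signed : Sign → Fin n → SignedFin n

posPart negPart : ∀ {n} → SignedFin n → ℕ
posPart (signed Sign.+ i) = suc (toℕ i)
posPart _                 = 0
negPart (signed Sign.- i) = suc (toℕ i)
negPart _                 = 0

Balanced : ∀ {e k} → (Fin k → SignedFin e) → Set
Balanced f = sum (posPart ∘ f) ≡ sum (negPart ∘ f)

injectₛ : ∀ {m} n → SignedFin m → SignedFin (m + n)
injectₛ n 0ₛ           = 0ₛ
injectₛ n (signed s i) = signed s (i ↑ˡ n)

Balanced-injectₛ : ∀ {e k} h (f : Fin k → SignedFin e) → Balanced f → Balanced (injectₛ h ∘ f)
Balanced-injectₛ h f balanced =
  trans (sum-cong-≗ (posPart-injectₛ ∘ f)) (trans balanced (sym (sum-cong-≗ (negPart-injectₛ ∘ f))))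
  where
    posPart-injectₛ : ∀ v → posPart (injectₛ h v) ≡ posPart v
    posPart-injectₛ 0ₛ                = refl
    posPart-injectₛ (signed Sign.+ i) = cong suc (toℕ-↑ˡ i h)
    posPart-injectₛ (signed Sign.- i) = refl

    negPart-injectₛ : ∀ v → negPart (injectₛ h v) ≡ negPart v
    negPart-injectₛ 0ₛ                = refl
    negPart-injectₛ (signed Sign.+ i) = refl
    negPart-injectₛ (signed Sign.- i) = cong suc (toℕ-↑ˡ i h)

module _ (m n : ℕ) where

  private
    to′ : SignedFin (m + n) → SignedFin m ⊎ (Sign × Fin n)
    to′ 0ₛ           = inj₁ 0ₛ
    to′ (signed s i) = Sum.map (signed s) (s ,_) (splitAt m i)

    from′ : SignedFin m ⊎ (Sign × Fin n) → SignedFin (m + n)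
    from′ (inj₁ v)       = injectₛ n v
    from′ (inj₂ (s , j)) = signed s (m ↑ʳ j)

    to-from : ∀ x → to′ (from′ x) ≡ x
    to-from (inj₁ 0ₛ)           = refl
    to-from (inj₁ (signed s i)) = cong (Sum.map (signed s) (s ,_)) (splitAt-↑ˡ m i n)
    to-from (inj₂ (s , j))      = cong (Sum.map (signed s) (s ,_)) (splitAt-↑ʳ m n j)

    from-map : ∀ s x → from′ (Sum.map (signed s) (s ,_) x) ≡ signed s (join m n x)
    from-map s (inj₁ i) = refl
    from-map s (inj₂ j) = refl

    from-to : ∀ v → from′ (to′ v) ≡ v
    from-to 0ₛ           = refl
    from-to (signed s i) = trans (from-map s (splitAt m i)) (cong (signed s) (join-splitAt m n i))

  magnitude↔ : SignedFin (m + n) ↔ (SignedFin m ⊎ (Sign × Fin n))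
  magnitude↔ = mk↔ₛ′ to′ from′ to-from from-to

mod-sum : ∀ {n} k (f : Fin k → ℕ) →
          sum f mod suc n ≡ ΣG (≡-AbelianGroup.abelianGroup (ℤ/ suc n)) k (λ i → f i mod suc n)
mod-sum zero    f = refl
mod-sum (suc k) f =
  trans (mod-distrib-+ (f zero) (sum (f ∘ suc))) (cong ((f zero mod _) +[mod]_) (mod-sum k (f ∘ suc)))

-- Residues modulo 1 + n = 1 + 2N: the negative numbers -1, …, -N occupy N + 1, …, 2N.
module _ {N n : ℕ} (N+N≡n : N + N ≡ n) where

  private
    side : Sign → Fin N → Fin N ⊎ Fin N
    side Sign.+ i = inj₁ i
    side Sign.- i = inj₂ (opposite i)

    unside : Fin N ⊎ Fin N → SignedFin N
    unside (inj₁ i) = signed Sign.+ i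
    unside (inj₂ i) = signed Sign.- (opposite i)

    unside-side : ∀ s i → unside (side s i) ≡ signed s i
    unside-side Sign.+ i = refl
    unside-side Sign.- i = cong (signed Sign.-) (opposite-involutive i)

  residue : SignedFin N → Fin (suc n)
  residue 0ₛ           = zero
  residue (signed s i) = suc (cast N+N≡n (join N N (side s i)))

  private
    unresidue : Fin (suc n) → SignedFin N
    unresidue zero    = 0ₛ
    unresidue (suc a) = unside (splitAt N (cast (sym N+N≡n) a))

    residue-unside : ∀ x → residue (unside x) ≡ suc (cast N+N≡n (join N N x))
    residue-unside (inj₁ i) = refl
    residue-unside (inj₂ i) = cong (λ j → suc (cast N+N≡n (N ↑ʳ j))) (opposite-involutive i)

    residue-unresidue : ∀ a → residue (unresidue a) ≡ a
    residue-unresidue zero    = refl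
    residue-unresidue (suc a) = begin
      residue (unside (splitAt N a′))             ≡⟨ residue-unside (splitAt N a′) ⟩
      suc (cast N+N≡n (join N N (splitAt N a′)))  ≡⟨ cong (suc ∘ cast N+N≡n) (join-splitAt N N a′) ⟩
      suc (cast N+N≡n a′)                         ≡⟨ cong suc (cast-involutive N+N≡n (sym N+N≡n) a) ⟩
      suc a                                       ∎
      where
        open ≡-Reasoning
        a′ : Fin (N + N)
        a′ = cast (sym N+N≡n) a

    unresidue-residue : ∀ v → unresidue (residue v) ≡ v
    unresidue-residue 0ₛ           = refl
    unresidue-residue (signed s i) = begin
      unside (splitAt N (cast (sym N+N≡n) (cast N+N≡n (join N N (side s i)))))
        ≡⟨ cong (unside ∘ splitAt N) (cast-involutive (sym N+N≡n) N+N≡n _) ⟩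
      unside (splitAt N (join N N (side s i)))   ≡⟨ cong unside (splitAt-join N N (side s i)) ⟩
      unside (side s i)                          ≡⟨ unside-side s i ⟩
      signed s i                                 ∎
      where open ≡-Reasoning

  residue↔ : SignedFin N ↔ Fin (suc n)
  residue↔ = mk↔ₛ′ residue unresidue residue-unresidue unresidue-residue

  private
    ℤₚ : ≡-AbelianGroup
    ℤₚ = ℤ/ suc n
  open ≡-AbelianGroup ℤₚ using (_∙_; _⁻¹; _·_; ε⁻¹≈ε; inverseʳ; identityˡ; identityʳ; abelianGroup)

  private
    toℕ-residue-+ : ∀ i → toℕ (residue (signed Sign.+ i)) ≡ suc (toℕ i)
    toℕ-residue-+ i = cong suc (trans (toℕ-cast N+N≡n (i ↑ˡ N)) (toℕ-↑ˡ i N))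

    toℕ-residue-- : ∀ i → toℕ (residue (signed Sign.- i)) ≡ suc n ∸ suc (toℕ i)
    toℕ-residue-- i = begin
      suc (toℕ (cast N+N≡n (N ↑ʳ opposite i)))  ≡⟨ cong suc (trans (toℕ-cast N+N≡n _) (toℕ-↑ʳ N (opposite i))) ⟩
      suc (N + toℕ (opposite i))                ≡⟨ cong (λ k → suc (N + k)) (opposite-prop i) ⟩
      suc (N + (N ∸ suc (toℕ i)))               ≡⟨ +-suc N (N ∸ suc (toℕ i)) ⟨
      N + suc (N ∸ suc (toℕ i))                 ≡⟨ cong (N +_) (+-∸-assoc 1 (toℕ<n i)) ⟨
      N + (N ∸ toℕ i)                           ≡⟨ +-∸-assoc N (<⇒≤ (toℕ<n i)) ⟨
      N + N ∸ toℕ i                             ≡⟨ cong (_∸ toℕ i) N+N≡n ⟩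
      n ∸ toℕ i                                 ∎
      where open ≡-Reasoning

  residue-signed : ∀ s i → residue (signed s i) ≡ s · (suc (toℕ i) mod suc n)
  residue-signed Sign.+ i = trans (sym (toℕ-mod-inverse _)) (cong (_mod suc n) (toℕ-residue-+ i))
  residue-signed Sign.- i = begin
    residue (signed Sign.- i)                              ≡⟨ toℕ-mod-inverse _ ⟨
    toℕ (residue (signed Sign.- i)) mod suc n              ≡⟨ cong (_mod suc n) (toℕ-residue-- i) ⟩
    (suc n ∸ suc (toℕ i)) mod suc n                        ≡⟨ cong (λ k → (suc n ∸ k) mod suc n) (toℕ-residue-+ i) ⟨
    (suc n ∸ toℕ (residue (signed Sign.+ i))) mod suc n    ≡⟨ cong _⁻¹ (residue-signed Sign.+ i) ⟩
    (suc (toℕ i) mod suc n) ⁻¹                             ∎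
    where open ≡-Reasoning

  residue-parts : ∀ v → residue v ≡ (posPart v mod suc n) ∙ (negPart v mod suc n) ⁻¹
  residue-parts 0ₛ                = sym (inverseʳ zero)
  residue-parts (signed Sign.+ i) =
    trans (residue-signed Sign.+ i) (sym (trans (cong ((suc (toℕ i) mod suc n) ∙_) ε⁻¹≈ε) (identityʳ _)))
  residue-parts (signed Sign.- i) = trans (residue-signed Sign.- i) (sym (identityˡ _))

  ZeroSum-residue : ∀ k (f : Fin k → SignedFin N) → Balanced f → ZeroSum ℤₚ (residue ∘ f)
  ZeroSum-residue k f balanced = begin
    ΣG abelianGroup k (residue ∘ f)                         ≡⟨ ΣG-cong abelianGroup k (residue-parts ∘ f) ⟩
    ΣG abelianGroup k (λ i → P i ∙ Q i ⁻¹)                  ≡⟨ ΣG-∙ abelianGroup k P (λ i → Q i ⁻¹) ⟩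
    ΣG abelianGroup k P ∙ ΣG abelianGroup k (λ i → Q i ⁻¹)
      ≡⟨ cong (ΣG abelianGroup k P ∙_) (ΣG-· ℤₚ Sign.- k Q) ⟨
    ΣG abelianGroup k P ∙ ΣG abelianGroup k Q ⁻¹
      ≡⟨ cong₂ (λ x y → x ∙ y ⁻¹) (mod-sum k (posPart ∘ f)) (mod-sum k (negPart ∘ f)) ⟨
    (sum (posPart ∘ f) mod suc n) ∙ (sum (negPart ∘ f) mod suc n) ⁻¹
      ≡⟨ cong (λ x → (sum (posPart ∘ f) mod suc n) ∙ (x mod suc n) ⁻¹) balanced ⟨
    (sum (posPart ∘ f) mod suc n) ∙ (sum (posPart ∘ f) mod suc n) ⁻¹
      ≡⟨ inverseʳ (sum (posPart ∘ f) mod suc n) ⟩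
    zero                                                    ∎
    where
      open ≡-Reasoning
      P Q : Fin k → Fin (suc n)
      P i = posPart (f i) mod suc n
      Q i = negPart (f i) mod suc n

-- Cores

-- A core for S consists of arrays over {0, ±1, …, ±e} × S whose first coordinates already sum
-- to zero in ℤ, so that they can be read modulo any odd p ≥ 2e + 1, together with a partition
-- of S into zero-sum quadruples in which g and g ⁻¹ always share a column sign.
record Core (e : ℕ) (S : ≡-AbelianGroup) : Set where
  open ≡-AbelianGroup S using (Carrier; _⁻¹)
  field
    z                : ℕ
    core↔            : Cell (suc (e * 2)) 4 z ↔ (SignedFin e × Carrier)
    core-rows        : ∀ k r → Balanced (λ j → proj₁ (to core↔ (k , r , j))) ×
                               ZeroSum S (λ j → proj₂ (to core↔ (k , r , j)))
    core-cols        : ∀ k j → Balanced (λ r → proj₁ (to core↔ (k , r , j))) ×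
                               ZeroSum S (λ r → proj₂ (to core↔ (k , r , j)))
    quadruple↔       : (Fin z × Fin 4) ↔ Carrier
    quadruple-sums   : ∀ k → ZeroSum S (λ j → to quadruple↔ (k , j))
    quadruple-⁻¹-side : ∀ c c′ → to quadruple↔ c′ ≡ to quadruple↔ c ⁻¹ →
                        columnSign (proj₂ c′) ≡ columnSign (proj₂ c)

module _ {e : ℕ} {S : ≡-AbelianGroup} (C : Core e S) where

  open Core C renaming (quadruple↔ to Q)
  open ≡-AbelianGroup S

  private

    columnSign-· : ∀ b g → columnSign (proj₂ (from Q (b · g))) ≡ columnSign (proj₂ (from Q g))
    columnSign-· Sign.+ g = refl
    columnSign-· Sign.- g = quadruple-⁻¹-side (from Q g) (from Q (g ⁻¹))
      (trans (strictlyInverseˡ Q (g ⁻¹)) (cong _⁻¹ (sym (strictlyInverseˡ Q g))))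

    *-cancelʳ : ∀ s t → (s Sign.* t) Sign.* t ≡ s
    *-cancelʳ s t = trans (Sign.*-assoc s t t) (trans (cong (s Sign.*_) (Sign.s*s≡+ t)) (Sign.*-identityʳ s))

    to′ : Sign × (Fin z × Fin 4) → Sign × Carrier
    to′ (b , k , j) = b Sign.* columnSign j , b · to Q (k , j)

    from′ : Sign × Carrier → Sign × (Fin z × Fin 4)
    from′ (s , g) = let b = s Sign.* columnSign (proj₂ (from Q g)) in b , from Q (b · g)

    to-from : ∀ x → to′ (from′ x) ≡ x
    to-from (s , g) = cong₂ _,_
      (begin
        b Sign.* columnSign (proj₂ (from Q (b · g)))  ≡⟨ cong (b Sign.*_) (columnSign-· b g) ⟩
        b Sign.* columnSign (proj₂ (from Q g))        ≡⟨ *-cancelʳ s _ ⟩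
        s                                             ∎)
      (trans (cong (b ·_) (strictlyInverseˡ Q (b · g))) (·-involutive b g))
      where
        open ≡-Reasoning
        b : Sign
        b = s Sign.* columnSign (proj₂ (from Q g))

    from-to : ∀ x → from′ (to′ x) ≡ x
    from-to (b , k , j) = cong₂ _,_ b′≡b (begin
      from Q (b′ · b · q)   ≡⟨ cong (λ t → from Q (t · b · q)) b′≡b ⟩
      from Q (b · b · q)    ≡⟨ cong (from Q) (·-involutive b q) ⟩
      from Q q              ≡⟨ strictlyInverseʳ Q (k , j) ⟩
      (k , j)               ∎)
      where
        open ≡-Reasoning
        q : Carrier
        q = to Q (k , j)
        b′ : Sign
        b′ = (b Sign.* columnSign j) Sign.* columnSign (proj₂ (from Q (b · q)))
        b′≡b : b′ ≡ b
        b′≡b = trans (cong ((b Sign.* columnSign j) Sign.*_)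
                            (trans (columnSign-· b q) (cong (columnSign ∘ proj₂) (strictlyInverseʳ Q (k , j)))))
                     (*-cancelʳ b (columnSign j))

  signedQuadruple↔ : (Sign × (Fin z × Fin 4)) ↔ (Sign × Carrier)
  signedQuadruple↔ = mk↔ₛ′ to′ from′ to-from from-to

-- After the core rows, row (m , b) of array k holds (b σⱼ (e + 1 + m) , b qₖⱼ) in column j,
-- where σ = columnSign and q is the quadruple partition.
module _ {e : ℕ} {S : ≡-AbelianGroup} (C : Core e S) (h : ℕ) where

  open Core C
  open ≡-AbelianGroup S using (Carrier; _·_)

  private
    c n : ℕ
    c = suc (e * 2)
    n = e * 2 + h * 2

    ℤₚ G : ≡-AbelianGroup
    ℤₚ = ℤ/ suc n
    G  = ℤₚ ×ᴳ S
    module ℤₚ = ≡-AbelianGroup ℤₚ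
    module S  = ≡-AbelianGroup S
    module G  = ≡-AbelianGroup G

    N+N≡n : (e + h) + (e + h) ≡ n
    N+N≡n = lemma e h
      where
        lemma : ∀ e h → (e + h) + (e + h) ≡ e * 2 + h * 2
        lemma = solve-∀

    regroup-rows : (Fin z × (Fin c ⊎ (Fin h × Sign)) × Fin 4) ↔
                   (Cell c 4 z ⊎ (Fin h × (Sign × (Fin z × Fin 4))))
    regroup-rows = mk↔ₛ′
      (λ { (k , inj₁ r , j) → inj₁ (k , r , j) ; (k , inj₂ (m , b) , j) → inj₂ (m , b , k , j) })
      (λ { (inj₁ (k , r , j)) → k , inj₁ r , j ; (inj₂ (m , b , k , j)) → k , inj₂ (m , b) , j })
      (λ { (inj₁ _) → refl ; (inj₂ _) → refl })
      (λ { (_ , inj₁ _ , _) → refl ; (_ , inj₂ _ , _) → refl })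

    regroup-values : ((SignedFin e × Carrier) ⊎ (Fin h × (Sign × Carrier))) ↔
                     ((SignedFin e ⊎ (Sign × Fin h)) × Carrier)
    regroup-values = mk↔ₛ′
      (λ { (inj₁ (v , g)) → inj₁ v , g ; (inj₂ (m , s , g)) → inj₂ (s , m) , g })
      (λ { (inj₁ v , g) → inj₁ (v , g) ; (inj₂ (s , m) , g) → inj₂ (m , s , g) })
      (λ { (inj₁ _ , _) → refl ; (inj₂ _ , _) → refl })
      (λ { (inj₁ _) → refl ; (inj₂ _) → refl })

    entry↔ : (Fin z × (Fin c ⊎ (Fin h × Sign)) × Fin 4) ↔ (Fin (suc n) × Carrier)
    entry↔ = ↔-trans regroup-rows (↔-trans (core↔ ⊎-↔ (↔-refl ×-↔ signedQuadruple↔ C))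
               (↔-trans regroup-values (↔-trans (↔-sym (magnitude↔ e h)) (residue↔ N+N≡n) ×-↔ ↔-refl)))

    entry : Fin z → Fin c ⊎ (Fin h × Sign) → Fin 4 → Fin (suc n) × Carrier
    entry k r j = to entry↔ (k , r , j)

    magnitude : Fin h → Fin (suc n)
    magnitude m = suc (toℕ (e ↑ʳ m)) mod suc n

    pair-entry : ∀ k m b j → entry k (inj₂ (m , b)) j ≡
                             (b ℤₚ.· columnSign j ℤₚ.· magnitude m , b · to quadruple↔ (k , j))
    pair-entry k m b j = cong (_, b · to quadruple↔ (k , j))
      (trans (residue-signed N+N≡n (b Sign.* columnSign j) (e ↑ʳ m)) (ℤₚ.·-* b (columnSign j) (magnitude m)))

    core-line : ∀ {k} (f : Fin k → SignedFin e × Carrier) → Balanced (proj₁ ∘ f) × ZeroSum S (proj₂ ∘ f) →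
                ZeroSum G (λ i → residue N+N≡n (injectₛ h (proj₁ (f i))) , proj₂ (f i))
    core-line {k} f (balanced , zero-sum) =
      trans (ΣG-× ℤₚ S k (λ i → residue N+N≡n (injectₛ h (proj₁ (f i))) , proj₂ (f i))) (cong₂ _,_
        (ZeroSum-residue N+N≡n k (injectₛ h ∘ proj₁ ∘ f) (Balanced-injectₛ h (proj₁ ∘ f) balanced)) zero-sum)

    row-sums : ∀ k r → ZeroSum G (λ j → entry k r j)
    row-sums k (inj₁ r)       = core-line (λ j → to core↔ (k , r , j)) (core-rows k r)
    row-sums k (inj₂ (m , b)) = trans (ΣG-cong G.abelianGroup 4 (pair-entry k m b))
      (trans (ΣG-× ℤₚ S 4 (λ j → b ℤₚ.· columnSign j ℤₚ.· magnitude m , b · to quadruple↔ (k , j)))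
             (cong₂ _,_
               (ZeroSum-· ℤₚ b (λ j → columnSign j ℤₚ.· magnitude m) (ZeroSum-columnSign ℤₚ (magnitude m)))
               (ZeroSum-· S b (λ j → to quadruple↔ (k , j)) (quadruple-sums k))))

    pair-cancel : ∀ k m j → entry k (inj₂ (m , Sign.+)) j G.∙ entry k (inj₂ (m , Sign.-)) j ≡ G.ε
    pair-cancel k m j = trans (cong₂ G._∙_ (pair-entry k m Sign.+ j) (pair-entry k m Sign.- j))
      (cong₂ _,_ (ℤₚ.inverseʳ (columnSign j ℤₚ.· magnitude m)) (S.inverseʳ (to quadruple↔ (k , j))))

    col-sums : ∀ k j → ZeroSum G (λ i → entry k (to (pairedRows↔ c h) i) j)
    col-sums k j = begin
      ΣG G.abelianGroup (c + h * 2) (λ i → entry k (to (pairedRows↔ c h) i) j)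
        ≡⟨ ΣG-pairedRows G.abelianGroup c h (λ r → entry k r j) ⟩
      ΣG G.abelianGroup c (λ r → entry k (inj₁ r) j) G.∙
      ΣG G.abelianGroup h (λ m → entry k (inj₂ (m , Sign.+)) j G.∙ entry k (inj₂ (m , Sign.-)) j)
        ≡⟨ cong₂ G._∙_ (core-line (λ r → to core↔ (k , r , j)) (core-cols k j))
                       (trans (ΣG-cong G.abelianGroup h (λ m → pair-cancel k m j)) (ΣG-ε G.abelianGroup h)) ⟩
      G.ε G.∙ G.ε
        ≡⟨ G.identityˡ G.ε ⟩
      G.ε ∎
      where open ≡-Reasoning

  core⇒mrs* : MRS* (≡-AbelianGroup.abelianGroup (ℤ/ suc (e * 2 + h * 2) ×ᴳ S)) (suc (e * 2) + h * 2) 4 z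
  core⇒mrs* = mrs*-from-↔ G (↔-trans (↔-refl ×-↔ (pairedRows↔ c h ×-↔ ↔-refl)) entry↔)
                            (λ k i → row-sums k (to (pairedRows↔ c h) i)) col-sums

-- Adding a factor T × T

twist↔ : ∀ {C W : Set} → (C → W ↔ W) → (C × W) ↔ (C × W)
twist↔ f = mk↔ₛ′ (λ (c , w) → c , to (f c) w) (λ (c , w) → c , from (f c) w)
                 (λ (c , w) → cong (c ,_) (strictlyInverseˡ (f c) w))
                 (λ (c , w) → cong (c ,_) (strictlyInverseʳ (f c) w))

-- Cell (k , w) of the new arrays is cell k of the old ones, extended by columnSign j · X i w:
-- the signs (+ + − −) cancel along rows, and Σᵢ X i w = 0 along columns.
module _ (H W : ≡-AbelianGroup) {x z m : ℕ} where

  private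
    module H = ≡-AbelianGroup H
    module W = ≡-AbelianGroup W

  extend-by-family : Fin m ↔ W.Carrier → (X : Fin x → W.Carrier ↔ W.Carrier) →
                     (∀ w → ZeroSum W (λ i → to (X i) w)) →
                     MRS* H.abelianGroup x 4 z → MRS* (≡-AbelianGroup.abelianGroup (H ×ᴳ W)) x 4 (z * m)
  extend-by-family enum X balanced M = mrs*-from-↔ (H ×ᴳ W) cells row-sums′ col-sums′
    where
      open MRS* M

      regroup : ((Fin z × Fin m) × Fin x × Fin 4) ↔ (Cell x 4 z × Fin m)
      regroup = mk↔ₛ′ (λ ((k , w) , i , j) → (k , i , j) , w) (λ ((k , i , j) , w) → (k , w) , i , j)
                      (λ _ → refl) (λ _ → refl)

      cells : Cell x 4 (z * m) ↔ (H.Carrier × W.Carrier)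
      cells = ↔-trans (*↔× {z} ×-↔ ↔-refl) (↔-trans regroup (↔-trans (↔-refl ×-↔ enum)
                (↔-trans (twist↔ (λ (k , i , j) → ↔-trans (X i) (W.·↔ (columnSign j))))
                         (cell↔ H M ×-↔ ↔-refl))))

      row-sums′ : ∀ k′ i → ZeroSum (H ×ᴳ W) (λ j → to cells (k′ , i , j))
      row-sums′ k′ i = trans (ΣG-× H W 4 (λ j → to cells (k′ , i , j)))
                             (cong₂ _,_ (row-sums _ i) (ZeroSum-columnSign W _))

      col-sums′ : ∀ k′ j → ZeroSum (H ×ᴳ W) (λ i → to cells (k′ , i , j))
      col-sums′ k′ j = trans (ΣG-× H W x (λ i → to cells (k′ , i , j)))
                             (cong₂ _,_ (col-sums _ j) (ZeroSum-· W (columnSign j) (λ i → to (X i) w) (balanced w)))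
        where
          w : W.Carrier
          w = to enum (proj₂ (to (*↔× {z}) k′))

-- θ cyclically permutes the zero-sum triple (x , y , (x ∙ y) ⁻¹), so θ³ = 1 and 1 + θ + θ² = 0.
module _ (T : ≡-AbelianGroup) where

  open ≡-AbelianGroup T
  private
    module T² = ≡-AbelianGroup (T ×ᴳ T)
    open AbelianGroupProperties abelianGroup using (inverseʳ-unique)

    rotate : ∀ {a b c} → a ∙ b ∙ c ≡ ε → b ∙ c ∙ a ≡ ε
    rotate {a} {b} {c} abc≡ε = trans (comm (b ∙ c) a) (trans (sym (assoc a b c)) abc≡ε)

    rotate-inverse : ∀ {a b c} → a ∙ b ∙ c ≡ ε → a ≡ (b ∙ c) ⁻¹
    rotate-inverse abc≡ε = inverseʳ-unique _ _ (rotate abc≡ε)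

  θ : Carrier × Carrier → Carrier × Carrier
  θ (x , y) = y , (x ∙ y) ⁻¹

  θ³≡id : ∀ w → θ (θ (θ w)) ≡ w
  θ³≡id (x , y) = cong₂ _,_ (sym x≡) (begin
    (z ∙ (y ∙ z) ⁻¹) ⁻¹  ≡⟨ cong (λ t → (z ∙ t) ⁻¹) x≡ ⟨
    (z ∙ x) ⁻¹           ≡⟨ rotate-inverse (rotate (inverseʳ (x ∙ y))) ⟨
    y                    ∎)
    where
      open ≡-Reasoning
      z : Carrier
      z = (x ∙ y) ⁻¹
      x≡ : x ≡ (y ∙ z) ⁻¹
      x≡ = rotate-inverse (inverseʳ (x ∙ y))

  θ↔ : (Carrier × Carrier) ↔ (Carrier × Carrier)
  θ↔ = mk↔ₛ′ θ (θ ∘ θ) θ³≡id θ³≡id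

  θ-powers : Fin 3 → (Carrier × Carrier) ↔ (Carrier × Carrier)
  θ-powers 0F = ↔-refl
  θ-powers 1F = θ↔
  θ-powers 2F = ↔-trans θ↔ θ↔

  θ-powers-sum : ∀ w → ZeroSum (T ×ᴳ T) (λ r → to (θ-powers r) w)
  θ-powers-sum (x , y) = cong₂ _,_ (triple-sum x y) (triple-sum y ((x ∙ y) ⁻¹))
    where
      triple-sum : ∀ a b → a ∙ (b ∙ ((a ∙ b) ⁻¹ ∙ ε)) ≡ ε
      triple-sum a b = trans (cong (λ t → a ∙ (b ∙ t)) (identityʳ _)) (trans (sym (assoc a b _)) (inverseʳ (a ∙ b)))

  θ-family : ∀ h → Fin (3 + h * 2) → (Carrier × Carrier) ↔ (Carrier × Carrier)
  θ-family h = [ θ-powers , (λ (_ , s) → T².·↔ s) ]′ ∘ to (pairedRows↔ 3 h)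

  θ-family-balanced : ∀ h w → ZeroSum (T ×ᴳ T) (λ i → to (θ-family h i) w)
  θ-family-balanced h w = begin
    ΣG T².abelianGroup (3 + h * 2) (λ i → to (θ-family h i) w)
      ≡⟨ ΣG-pairedRows T².abelianGroup 3 h (λ r → to ([ θ-powers , (λ (_ , s) → T².·↔ s) ]′ r) w) ⟩
    ΣG T².abelianGroup 3 (λ r → to (θ-powers r) w) T².∙ ΣG T².abelianGroup h (λ _ → w T².∙ w T².⁻¹)
      ≡⟨ cong₂ T²._∙_ (θ-powers-sum w)
                      (trans (ΣG-cong T².abelianGroup h (λ _ → T².inverseʳ w)) (ΣG-ε T².abelianGroup h)) ⟩
    T².ε T².∙ T².ε
      ≡⟨ T².identityˡ T².ε ⟩
    T².ε ∎
    where open ≡-Reasoning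

extend-by-square : (H T : ≡-AbelianGroup) {h z t : ℕ} → Fin t ↔ ≡-AbelianGroup.Carrier T →
                   MRS* (≡-AbelianGroup.abelianGroup H) (3 + h * 2) 4 z →
                   MRS* (≡-AbelianGroup.abelianGroup (H ×ᴳ T ×ᴳ T)) (3 + h * 2) 4 (z * (t * t))
extend-by-square H T {h} enum =
  extend-by-family H (T ×ᴳ T) (↔-trans *↔× (enum ×-↔ enum)) (θ-family T h) (θ-family-balanced T h)

record Exhaustible (A : Set) : Set₁ where
  field
    all? : ∀ {P : Pred A 0ℓ} → Decidable P → Dec (∀ a → P a)
    any? : ∀ {P : Pred A 0ℓ} → Decidable P → Dec (∃ P)

open Exhaustible

Fin-exhaustible : ∀ {n} → Exhaustible (Fin n)
Fin-exhaustible = record { all? = Fin.all? ; any? = Fin.any? }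

infixr 2 _×-exhaustible_
_×-exhaustible_ : ∀ {A B} → Exhaustible A → Exhaustible B → Exhaustible (A × B)
A? ×-exhaustible B? = record
  { all? = λ P? → map′ (λ h (a , b) → h a b) (λ h a b → h (a , b))
                       (all? A? λ a → all? B? λ b → P? (a , b))
  ; any? = λ P? → map′ (λ (a , b , p) → (a , b) , p) (λ ((a , b) , p) → a , b , p)
                       (any? A? λ a → any? B? λ b → P? (a , b))
  }

Vec-exhaustible : ∀ {A n} → Exhaustible A → Exhaustible (Vec A n)
Vec-exhaustible {n = zero} A? = record
  { all? = λ P? → map′ (λ { p [] → p }) (λ h → h []) (P? [])
  ; any? = λ P? → map′ ([] ,_) (λ { ([] , p) → p }) (P? [])
  }
Vec-exhaustible {n = suc n} A? = record
  { all? = λ P? → map′ (λ { h (x ∷ xs) → h (x , xs) }) (λ h (x , xs) → h (x ∷ xs))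
                       (all? (A? ×-exhaustible Vec-exhaustible A?) λ (x , xs) → P? (x ∷ xs))
  ; any? = λ P? → map′ (λ ((x , xs) , p) → x ∷ xs , p) (λ { (x ∷ xs , p) → (x , xs) , p })
                       (any? (A? ×-exhaustible Vec-exhaustible A?) λ (x , xs) → P? (x ∷ xs))
  }

Sign-exhaustible : Exhaustible Sign
Sign-exhaustible = record
  { all? = λ P? → map′ (λ { (p , q) Sign.+ → p ; (p , q) Sign.- → q }) (λ h → h Sign.+ , h Sign.-)
                       (P? Sign.+ ×-dec P? Sign.-)
  ; any? = λ P? → map′ (λ { (inj₁ p) → Sign.+ , p ; (inj₂ q) → Sign.- , q })
                       (λ { (Sign.+ , p) → inj₁ p ; (Sign.- , q) → inj₂ q })
                       (P? Sign.+ ⊎-dec P? Sign.-)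
  }

SignedFin-exhaustible : ∀ {n} → Exhaustible (SignedFin n)
SignedFin-exhaustible = record
  { all? = λ P? → map′ (λ { (p , q) 0ₛ → p ; (p , q) (signed s i) → q (s , i) })
                       (λ h → h 0ₛ , λ (s , i) → h (signed s i))
                       (P? 0ₛ ×-dec all? signs λ (s , i) → P? (signed s i))
  ; any? = λ P? → map′ (λ { (inj₁ p) → 0ₛ , p ; (inj₂ ((s , i) , q)) → signed s i , q })
                       (λ { (0ₛ , p) → inj₁ p ; (signed s i , q) → inj₂ ((s , i) , q) })
                       (P? 0ₛ ⊎-dec any? signs λ (s , i) → P? (signed s i))
  }
  where
    signs : Exhaustible (Sign × Fin _)
    signs = Sign-exhaustible ×-exhaustible Fin-exhaustible

_≟ₛ_ : ∀ {n} → DecidableEquality (SignedFin n)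
0ₛ         ≟ₛ 0ₛ         = yes refl
0ₛ         ≟ₛ signed _ _ = no λ ()
signed _ _ ≟ₛ 0ₛ         = no λ ()
signed s i ≟ₛ signed t j = map′ (λ (s≡t , i≡j) → cong₂ signed s≡t i≡j) (λ { refl → refl , refl })
                                (s Sign.≟ t ×-dec i Fin.≟ j)

module Search {A B : Set} (A? : Exhaustible A) (_≟ᴬ_ : DecidableEquality A) (_≟ᴮ_ : DecidableEquality B)
              (f : A → B) where

  search : B → Maybe A
  search b = Maybe.map proj₁ (dec⇒maybe (any? A? λ a → f a ≟ᴮ b))

  SearchInvertible : Set
  SearchInvertible = (∀ b → ∃ λ a → f a ≡ b) × (∀ a → search (f a) ≡ just a)

  searchInvertible? : Exhaustible B → Dec SearchInvertible
  searchInvertible? B? = all? B? (λ b → any? A? λ a → f a ≟ᴮ b)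
                   ×-dec all? A? (λ a → Maybe.≡-dec _≟ᴬ_ (search (f a)) (just a))

  ↔-by-search : SearchInvertible → A ↔ B
  ↔-by-search (surjective , search-f) = mk↔ₛ′ f (proj₁ ∘ surjective) (proj₂ ∘ surjective)
    (λ a → just-injective (trans (sym (search-f _)) (trans (cong search (proj₂ (surjective (f a)))) (search-f a))))

module BySearch (H : ≡-AbelianGroup) (H? : Exhaustible (≡-AbelianGroup.Carrier H))
                (_≟_ : DecidableEquality (≡-AbelianGroup.Carrier H)) where

  open ≡-AbelianGroup H

  private
    cells? : ∀ {x y z} → Exhaustible (Cell x y z)
    cells? = Fin-exhaustible ×-exhaustible Fin-exhaustible ×-exhaustible Fin-exhaustible

    _≟ᶜ_ : ∀ {x y z} → DecidableEquality (Cell x y z)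
    _≟ᶜ_ = Product.≡-dec Fin._≟_ (Product.≡-dec Fin._≟_ Fin._≟_)

    ZeroSum? : ∀ {n} (f : Fin n → Carrier) → Dec (ZeroSum H f)
    ZeroSum? f = ΣG abelianGroup _ f ≟ ε

  module _ {x y z : ℕ} (A : Vec (Vec (Vec Carrier y) x) z) where

    private
      cell : Cell x y z → Carrier
      cell (k , i , j) = lookup (lookup (lookup A k) i) j
      open Search cells? _≟ᶜ_ _≟_ cell

      checks? : Dec (SearchInvertible × (∀ k i → ZeroSum H (λ j → cell (k , i , j)))
                                      × (∀ k j → ZeroSum H (λ i → cell (k , i , j))))
      checks? = searchInvertible? H?
        ×-dec Fin.all? (λ k → Fin.all? λ i → ZeroSum? (λ j → cell (k , i , j)))
        ×-dec Fin.all? (λ k → Fin.all? λ j → ZeroSum? (λ i → cell (k , i , j)))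

    mrs*-by-search : {True checks?} → MRS* abelianGroup x y z
    mrs*-by-search {ok} = let invertible , rows , cols = toWitness ok in
      mrs*-from-↔ H (↔-by-search invertible) rows cols

  module _ {e z : ℕ} (T : Vec (Vec (Vec (SignedFin e × Carrier) 4) (suc (e * 2))) z)
           (Q : Vec (Vec Carrier 4) z) where

    private
      cell : Cell (suc (e * 2)) 4 z → SignedFin e × Carrier
      cell (k , r , j) = lookup (lookup (lookup T k) r) j

      quadruple : Fin z × Fin 4 → Carrier
      quadruple (k , j) = lookup (lookup Q k) j

      module Cells = Search cells? _≟ᶜ_ (Product.≡-dec _≟ₛ_ _≟_) cell
      module Quadruples = Search (Fin-exhaustible ×-exhaustible Fin-exhaustible)
                                 (Product.≡-dec Fin._≟_ Fin._≟_) _≟_ quadruple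

      Line? : ∀ {n} (f : Fin n → SignedFin e × Carrier) → Dec (Balanced (proj₁ ∘ f) × ZeroSum H (proj₂ ∘ f))
      Line? f = sum (posPart ∘ proj₁ ∘ f) ℕ.≟ sum (negPart ∘ proj₁ ∘ f) ×-dec ZeroSum? (proj₂ ∘ f)

      checks? : Dec (Cells.SearchInvertible × Quadruples.SearchInvertible
             × (∀ k r → Balanced (λ j → proj₁ (cell (k , r , j))) × ZeroSum H (λ j → proj₂ (cell (k , r , j))))
             × (∀ k j → Balanced (λ r → proj₁ (cell (k , r , j))) × ZeroSum H (λ r → proj₂ (cell (k , r , j))))
             × (∀ k → ZeroSum H (λ j → quadruple (k , j)))
             × (∀ c c′ → quadruple c′ ≡ quadruple c ⁻¹ → columnSign (proj₂ c′) ≡ columnSign (proj₂ c)))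
      checks? = Cells.searchInvertible? (SignedFin-exhaustible ×-exhaustible H?)
        ×-dec Quadruples.searchInvertible? H?
        ×-dec Fin.all? (λ k → Fin.all? λ r → Line? (λ j → cell (k , r , j)))
        ×-dec Fin.all? (λ k → Fin.all? λ j → Line? (λ r → cell (k , r , j)))
        ×-dec Fin.all? (λ k → ZeroSum? (λ j → quadruple (k , j)))
        ×-dec all? quadruples (λ c → all? quadruples λ c′ →
                (quadruple c′ ≟ (quadruple c ⁻¹)) →-dec (columnSign (proj₂ c′) Sign.≟ columnSign (proj₂ c)))
        where
          quadruples : Exhaustible (Fin z × Fin 4)
          quadruples = Fin-exhaustible ×-exhaustible Fin-exhaustible

    core-by-search : {True checks?} → Core e H
    core-by-search {ok} = let cells , quadruples , rows , cols , sums , ⁻¹-side = toWitness ok in record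
      { z                 = z
      ; core↔             = Cells.↔-by-search cells
      ; core-rows         = rows
      ; core-cols         = cols
      ; quadruple↔        = Quadruples.↔-by-search quadruples
      ; quadruple-sums    = sums
      ; quadruple-⁻¹-side = ⁻¹-side
      }

-- Each table is checked by evaluation: the hidden `True` argument of `core-by-search` and
-- `mrs*-by-search` is solved only if every check succeeds.
pattern +1ₛ = signed Sign.+ 0F
pattern -1ₛ = signed Sign.- 0F
pattern +2ₛ = signed Sign.+ 1F
pattern -2ₛ = signed Sign.- 1F

S₂-exhaustible : ∀ {α β} → Exhaustible (≡-AbelianGroup.Carrier (S₂ᴳ α β))
S₂-exhaustible = Vec-exhaustible Fin-exhaustible ×-exhaustible Vec-exhaustible Fin-exhaustible

_≟S₂_ : ∀ {α β} → DecidableEquality (≡-AbelianGroup.Carrier (S₂ᴳ α β))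
_≟S₂_ = Product.≡-dec (Vec.≡-dec Fin._≟_) (Vec.≡-dec Fin._≟_)

module S₂-BySearch (α β : ℕ) = BySearch (S₂ᴳ α β) S₂-exhaustible _≟S₂_
module ZpS2-BySearch (n α β : ℕ) = BySearch (ZpS2ᴳ (suc n) α β) (Fin-exhaustible ×-exhaustible S₂-exhaustible)
                                            (Product.≡-dec Fin._≟_ _≟S₂_)

core-ℤ₄² : Core 1 (S₂ᴳ 2 0)
core-ℤ₄² = S₂-BySearch.core-by-search 2 0
  ( ( ( (0ₛ  , 1F ∷ 2F ∷ [] , []) ∷ (+1ₛ , 2F ∷ 2F ∷ [] , []) ∷ (-1ₛ , 2F ∷ 2F ∷ [] , []) ∷ (0ₛ  , 3F ∷ 2F ∷ [] , []) ∷ [] )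
    ∷ ( (+1ₛ , 1F ∷ 3F ∷ [] , []) ∷ (-1ₛ , 1F ∷ 1F ∷ [] , []) ∷ (+1ₛ , 0F ∷ 3F ∷ [] , []) ∷ (-1ₛ , 2F ∷ 1F ∷ [] , []) ∷ [] )
    ∷ ( (-1ₛ , 2F ∷ 3F ∷ [] , []) ∷ (0ₛ  , 1F ∷ 1F ∷ [] , []) ∷ (0ₛ  , 2F ∷ 3F ∷ [] , []) ∷ (+1ₛ , 3F ∷ 1F ∷ [] , []) ∷ [] )
    ∷ [] )
  ∷ ( ( (0ₛ  , 0F ∷ 0F ∷ [] , []) ∷ (0ₛ  , 3F ∷ 3F ∷ [] , []) ∷ (+1ₛ , 1F ∷ 0F ∷ [] , []) ∷ (-1ₛ , 0F ∷ 1F ∷ [] , []) ∷ [] )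
    ∷ ( (-1ₛ , 0F ∷ 2F ∷ [] , []) ∷ (+1ₛ , 1F ∷ 2F ∷ [] , []) ∷ (-1ₛ , 1F ∷ 3F ∷ [] , []) ∷ (+1ₛ , 2F ∷ 1F ∷ [] , []) ∷ [] )
    ∷ ( (+1ₛ , 0F ∷ 2F ∷ [] , []) ∷ (-1ₛ , 0F ∷ 3F ∷ [] , []) ∷ (0ₛ  , 2F ∷ 1F ∷ [] , []) ∷ (0ₛ  , 2F ∷ 2F ∷ [] , []) ∷ [] )
    ∷ [] )
  ∷ ( ( (+1ₛ , 0F ∷ 0F ∷ [] , []) ∷ (-1ₛ , 0F ∷ 0F ∷ [] , []) ∷ (+1ₛ , 3F ∷ 0F ∷ [] , []) ∷ (-1ₛ , 1F ∷ 0F ∷ [] , []) ∷ [] )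
    ∷ ( (-1ₛ , 3F ∷ 0F ∷ [] , []) ∷ (+1ₛ , 0F ∷ 1F ∷ [] , []) ∷ (-1ₛ , 2F ∷ 0F ∷ [] , []) ∷ (+1ₛ , 3F ∷ 3F ∷ [] , []) ∷ [] )
    ∷ ( (0ₛ  , 1F ∷ 0F ∷ [] , []) ∷ (0ₛ  , 0F ∷ 3F ∷ [] , []) ∷ (0ₛ  , 3F ∷ 0F ∷ [] , []) ∷ (0ₛ  , 0F ∷ 1F ∷ [] , []) ∷ [] )
    ∷ [] )
  ∷ ( ( (-1ₛ , 3F ∷ 1F ∷ [] , []) ∷ (+1ₛ , 2F ∷ 0F ∷ [] , []) ∷ (0ₛ  , 1F ∷ 3F ∷ [] , []) ∷ (0ₛ  , 2F ∷ 0F ∷ [] , []) ∷ [] )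
    ∷ ( (0ₛ  , 0F ∷ 2F ∷ [] , []) ∷ (0ₛ  , 3F ∷ 1F ∷ [] , []) ∷ (+1ₛ , 2F ∷ 3F ∷ [] , []) ∷ (-1ₛ , 3F ∷ 2F ∷ [] , []) ∷ [] )
    ∷ ( (+1ₛ , 1F ∷ 1F ∷ [] , []) ∷ (-1ₛ , 3F ∷ 3F ∷ [] , []) ∷ (-1ₛ , 1F ∷ 2F ∷ [] , []) ∷ (+1ₛ , 3F ∷ 2F ∷ [] , []) ∷ [] )
    ∷ [] )
  ∷ [] )
  ( ( (0F ∷ 0F ∷ [] , []) ∷ (2F ∷ 0F ∷ [] , []) ∷ (0F ∷ 2F ∷ [] , []) ∷ (2F ∷ 2F ∷ [] , []) ∷ [] )
  ∷ ( (0F ∷ 1F ∷ [] , []) ∷ (0F ∷ 3F ∷ [] , []) ∷ (2F ∷ 1F ∷ [] , []) ∷ (2F ∷ 3F ∷ [] , []) ∷ [] )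
  ∷ ( (1F ∷ 0F ∷ [] , []) ∷ (3F ∷ 0F ∷ [] , []) ∷ (1F ∷ 2F ∷ [] , []) ∷ (3F ∷ 2F ∷ [] , []) ∷ [] )
  ∷ ( (1F ∷ 1F ∷ [] , []) ∷ (3F ∷ 3F ∷ [] , []) ∷ (3F ∷ 1F ∷ [] , []) ∷ (1F ∷ 3F ∷ [] , []) ∷ [] )
  ∷ [] )

core-ℤ₄×ℤ₂ : Core 1 (S₂ᴳ 1 1)
core-ℤ₄×ℤ₂ = S₂-BySearch.core-by-search 1 1
  ( ( ( (+1ₛ , 0F ∷ [] , 1F ∷ []) ∷ (-1ₛ , 0F ∷ [] , 1F ∷ []) ∷ (0ₛ  , 3F ∷ [] , 1F ∷ []) ∷ (0ₛ  , 1F ∷ [] , 1F ∷ []) ∷ [] )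
    ∷ ( (-1ₛ , 1F ∷ [] , 1F ∷ []) ∷ (+1ₛ , 2F ∷ [] , 1F ∷ []) ∷ (-1ₛ , 2F ∷ [] , 1F ∷ []) ∷ (+1ₛ , 3F ∷ [] , 1F ∷ []) ∷ [] )
    ∷ ( (0ₛ  , 3F ∷ [] , 0F ∷ []) ∷ (0ₛ  , 2F ∷ [] , 0F ∷ []) ∷ (+1ₛ , 3F ∷ [] , 0F ∷ []) ∷ (-1ₛ , 0F ∷ [] , 0F ∷ []) ∷ [] )
    ∷ [] )
  ∷ ( ( (+1ₛ , 0F ∷ [] , 0F ∷ []) ∷ (+1ₛ , 1F ∷ [] , 0F ∷ []) ∷ (-1ₛ , 1F ∷ [] , 0F ∷ []) ∷ (-1ₛ , 2F ∷ [] , 0F ∷ []) ∷ [] )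
    ∷ ( (-1ₛ , 3F ∷ [] , 0F ∷ []) ∷ (0ₛ  , 0F ∷ [] , 1F ∷ []) ∷ (+1ₛ , 1F ∷ [] , 1F ∷ []) ∷ (0ₛ  , 0F ∷ [] , 0F ∷ []) ∷ [] )
    ∷ ( (0ₛ  , 1F ∷ [] , 0F ∷ []) ∷ (-1ₛ , 3F ∷ [] , 1F ∷ []) ∷ (0ₛ  , 2F ∷ [] , 1F ∷ []) ∷ (+1ₛ , 2F ∷ [] , 0F ∷ []) ∷ [] )
    ∷ [] )
  ∷ [] )
  ( ( (0F ∷ [] , 0F ∷ []) ∷ (2F ∷ [] , 0F ∷ []) ∷ (0F ∷ [] , 1F ∷ []) ∷ (2F ∷ [] , 1F ∷ []) ∷ [] )
  ∷ ( (1F ∷ [] , 0F ∷ []) ∷ (3F ∷ [] , 0F ∷ []) ∷ (1F ∷ [] , 1F ∷ []) ∷ (3F ∷ [] , 1F ∷ []) ∷ [] )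
  ∷ [] )

core-ℤ₄×ℤ₂² : Core 1 (S₂ᴳ 1 2)
core-ℤ₄×ℤ₂² = S₂-BySearch.core-by-search 1 2
  ( ( ( (+1ₛ , 2F ∷ [] , 1F ∷ 1F ∷ []) ∷ (-1ₛ , 2F ∷ [] , 0F ∷ 1F ∷ []) ∷ (0ₛ  , 2F ∷ [] , 1F ∷ 0F ∷ []) ∷ (0ₛ  , 2F ∷ [] , 0F ∷ 0F ∷ []) ∷ [] )
    ∷ ( (-1ₛ , 0F ∷ [] , 0F ∷ 0F ∷ []) ∷ (+1ₛ , 3F ∷ [] , 0F ∷ 1F ∷ []) ∷ (-1ₛ , 2F ∷ [] , 1F ∷ 1F ∷ []) ∷ (+1ₛ , 3F ∷ [] , 1F ∷ 0F ∷ []) ∷ [] )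
    ∷ ( (0ₛ  , 2F ∷ [] , 1F ∷ 1F ∷ []) ∷ (0ₛ  , 3F ∷ [] , 0F ∷ 0F ∷ []) ∷ (+1ₛ , 0F ∷ [] , 0F ∷ 1F ∷ []) ∷ (-1ₛ , 3F ∷ [] , 1F ∷ 0F ∷ []) ∷ [] )
    ∷ [] )
  ∷ ( ( (-1ₛ , 3F ∷ [] , 1F ∷ 1F ∷ []) ∷ (+1ₛ , 3F ∷ [] , 0F ∷ 0F ∷ []) ∷ (-1ₛ , 0F ∷ [] , 1F ∷ 0F ∷ []) ∷ (+1ₛ , 2F ∷ [] , 0F ∷ 1F ∷ []) ∷ [] )
    ∷ ( (0ₛ  , 3F ∷ [] , 1F ∷ 1F ∷ []) ∷ (0ₛ  , 0F ∷ [] , 1F ∷ 0F ∷ []) ∷ (+1ₛ , 0F ∷ [] , 1F ∷ 0F ∷ []) ∷ (-1ₛ , 1F ∷ [] , 1F ∷ 1F ∷ []) ∷ [] )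
    ∷ ( (+1ₛ , 2F ∷ [] , 0F ∷ 0F ∷ []) ∷ (-1ₛ , 1F ∷ [] , 1F ∷ 0F ∷ []) ∷ (0ₛ  , 0F ∷ [] , 0F ∷ 0F ∷ []) ∷ (0ₛ  , 1F ∷ [] , 1F ∷ 0F ∷ []) ∷ [] )
    ∷ [] )
  ∷ ( ( (+1ₛ , 1F ∷ [] , 1F ∷ 1F ∷ []) ∷ (-1ₛ , 1F ∷ [] , 0F ∷ 0F ∷ []) ∷ (0ₛ  , 1F ∷ [] , 0F ∷ 0F ∷ []) ∷ (0ₛ  , 1F ∷ [] , 1F ∷ 1F ∷ []) ∷ [] )
    ∷ ( (0ₛ  , 3F ∷ [] , 1F ∷ 0F ∷ []) ∷ (0ₛ  , 0F ∷ [] , 1F ∷ 1F ∷ []) ∷ (+1ₛ , 0F ∷ [] , 0F ∷ 0F ∷ []) ∷ (-1ₛ , 1F ∷ [] , 0F ∷ 1F ∷ []) ∷ [] )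
    ∷ ( (-1ₛ , 0F ∷ [] , 0F ∷ 1F ∷ []) ∷ (+1ₛ , 3F ∷ [] , 1F ∷ 1F ∷ []) ∷ (-1ₛ , 3F ∷ [] , 0F ∷ 0F ∷ []) ∷ (+1ₛ , 2F ∷ [] , 1F ∷ 0F ∷ []) ∷ [] )
    ∷ [] )
  ∷ ( ( (+1ₛ , 0F ∷ [] , 1F ∷ 1F ∷ []) ∷ (-1ₛ , 0F ∷ [] , 1F ∷ 1F ∷ []) ∷ (-1ₛ , 3F ∷ [] , 0F ∷ 1F ∷ []) ∷ (+1ₛ , 1F ∷ [] , 0F ∷ 1F ∷ []) ∷ [] )
    ∷ ( (-1ₛ , 2F ∷ [] , 1F ∷ 0F ∷ []) ∷ (+1ₛ , 1F ∷ [] , 1F ∷ 0F ∷ []) ∷ (0ₛ  , 0F ∷ [] , 0F ∷ 1F ∷ []) ∷ (0ₛ  , 1F ∷ [] , 0F ∷ 1F ∷ []) ∷ [] )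
    ∷ ( (0ₛ  , 2F ∷ [] , 0F ∷ 1F ∷ []) ∷ (0ₛ  , 3F ∷ [] , 0F ∷ 1F ∷ []) ∷ (+1ₛ , 1F ∷ [] , 0F ∷ 0F ∷ []) ∷ (-1ₛ , 2F ∷ [] , 0F ∷ 0F ∷ []) ∷ [] )
    ∷ [] )
  ∷ [] )
  ( ( (0F ∷ [] , 0F ∷ 0F ∷ []) ∷ (2F ∷ [] , 0F ∷ 0F ∷ []) ∷ (0F ∷ [] , 1F ∷ 0F ∷ []) ∷ (2F ∷ [] , 1F ∷ 0F ∷ []) ∷ [] )
  ∷ ( (0F ∷ [] , 0F ∷ 1F ∷ []) ∷ (2F ∷ [] , 1F ∷ 1F ∷ []) ∷ (2F ∷ [] , 0F ∷ 1F ∷ []) ∷ (0F ∷ [] , 1F ∷ 1F ∷ []) ∷ [] )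
  ∷ ( (1F ∷ [] , 0F ∷ 0F ∷ []) ∷ (3F ∷ [] , 0F ∷ 0F ∷ []) ∷ (1F ∷ [] , 1F ∷ 0F ∷ []) ∷ (3F ∷ [] , 1F ∷ 0F ∷ []) ∷ [] )
  ∷ ( (1F ∷ [] , 0F ∷ 1F ∷ []) ∷ (3F ∷ [] , 0F ∷ 1F ∷ []) ∷ (1F ∷ [] , 1F ∷ 1F ∷ []) ∷ (3F ∷ [] , 1F ∷ 1F ∷ []) ∷ [] )
  ∷ [] )

core-ℤ₄²×ℤ₂ : Core 1 (S₂ᴳ 2 1)
core-ℤ₄²×ℤ₂ = S₂-BySearch.core-by-search 2 1
  ( ( ( (0ₛ  , 1F ∷ 0F ∷ [] , 1F ∷ []) ∷ (0ₛ  , 2F ∷ 3F ∷ [] , 0F ∷ []) ∷ (0ₛ  , 1F ∷ 0F ∷ [] , 0F ∷ []) ∷ (0ₛ  , 0F ∷ 1F ∷ [] , 1F ∷ []) ∷ [] )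
    ∷ ( (+1ₛ , 0F ∷ 3F ∷ [] , 0F ∷ []) ∷ (-1ₛ , 1F ∷ 3F ∷ [] , 0F ∷ []) ∷ (-1ₛ , 2F ∷ 3F ∷ [] , 0F ∷ []) ∷ (+1ₛ , 1F ∷ 3F ∷ [] , 0F ∷ []) ∷ [] )
    ∷ ( (-1ₛ , 3F ∷ 1F ∷ [] , 1F ∷ []) ∷ (+1ₛ , 1F ∷ 2F ∷ [] , 0F ∷ []) ∷ (+1ₛ , 1F ∷ 1F ∷ [] , 0F ∷ []) ∷ (-1ₛ , 3F ∷ 0F ∷ [] , 1F ∷ []) ∷ [] )
    ∷ [] )
  ∷ ( ( (0ₛ  , 2F ∷ 1F ∷ [] , 0F ∷ []) ∷ (0ₛ  , 3F ∷ 3F ∷ [] , 0F ∷ []) ∷ (-1ₛ , 2F ∷ 2F ∷ [] , 1F ∷ []) ∷ (+1ₛ , 1F ∷ 2F ∷ [] , 1F ∷ []) ∷ [] )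
    ∷ ( (+1ₛ , 0F ∷ 1F ∷ [] , 0F ∷ []) ∷ (-1ₛ , 0F ∷ 1F ∷ [] , 0F ∷ []) ∷ (+1ₛ , 1F ∷ 0F ∷ [] , 1F ∷ []) ∷ (-1ₛ , 3F ∷ 2F ∷ [] , 1F ∷ []) ∷ [] )
    ∷ ( (-1ₛ , 2F ∷ 2F ∷ [] , 0F ∷ []) ∷ (+1ₛ , 1F ∷ 0F ∷ [] , 0F ∷ []) ∷ (0ₛ  , 1F ∷ 2F ∷ [] , 0F ∷ []) ∷ (0ₛ  , 0F ∷ 0F ∷ [] , 0F ∷ []) ∷ [] )
    ∷ [] )
  ∷ ( ( (0ₛ  , 3F ∷ 1F ∷ [] , 1F ∷ []) ∷ (0ₛ  , 0F ∷ 3F ∷ [] , 1F ∷ []) ∷ (0ₛ  , 0F ∷ 3F ∷ [] , 0F ∷ []) ∷ (0ₛ  , 1F ∷ 1F ∷ [] , 0F ∷ []) ∷ [] )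
    ∷ ( (+1ₛ , 0F ∷ 1F ∷ [] , 1F ∷ []) ∷ (-1ₛ , 1F ∷ 1F ∷ [] , 0F ∷ []) ∷ (+1ₛ , 3F ∷ 2F ∷ [] , 1F ∷ []) ∷ (-1ₛ , 0F ∷ 0F ∷ [] , 0F ∷ []) ∷ [] )
    ∷ ( (-1ₛ , 1F ∷ 2F ∷ [] , 0F ∷ []) ∷ (+1ₛ , 3F ∷ 0F ∷ [] , 1F ∷ []) ∷ (-1ₛ , 1F ∷ 3F ∷ [] , 1F ∷ []) ∷ (+1ₛ , 3F ∷ 3F ∷ [] , 0F ∷ []) ∷ [] )
    ∷ [] )
  ∷ ( ( (+1ₛ , 2F ∷ 3F ∷ [] , 1F ∷ []) ∷ (+1ₛ , 3F ∷ 3F ∷ [] , 1F ∷ []) ∷ (-1ₛ , 2F ∷ 1F ∷ [] , 1F ∷ []) ∷ (-1ₛ , 1F ∷ 1F ∷ [] , 1F ∷ []) ∷ [] )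
    ∷ ( (0ₛ  , 2F ∷ 2F ∷ [] , 1F ∷ []) ∷ (-1ₛ , 2F ∷ 1F ∷ [] , 0F ∷ []) ∷ (+1ₛ , 0F ∷ 3F ∷ [] , 1F ∷ []) ∷ (0ₛ  , 0F ∷ 2F ∷ [] , 0F ∷ []) ∷ [] )
    ∷ ( (-1ₛ , 0F ∷ 3F ∷ [] , 0F ∷ []) ∷ (0ₛ  , 3F ∷ 0F ∷ [] , 1F ∷ []) ∷ (0ₛ  , 2F ∷ 0F ∷ [] , 0F ∷ []) ∷ (+1ₛ , 3F ∷ 1F ∷ [] , 1F ∷ []) ∷ [] )
    ∷ [] )
  ∷ ( ( (+1ₛ , 0F ∷ 0F ∷ [] , 1F ∷ []) ∷ (-1ₛ , 3F ∷ 3F ∷ [] , 1F ∷ []) ∷ (-1ₛ , 2F ∷ 0F ∷ [] , 0F ∷ []) ∷ (+1ₛ , 3F ∷ 1F ∷ [] , 0F ∷ []) ∷ [] )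
    ∷ ( (-1ₛ , 0F ∷ 3F ∷ [] , 1F ∷ []) ∷ (+1ₛ , 2F ∷ 0F ∷ [] , 1F ∷ []) ∷ (+1ₛ , 3F ∷ 0F ∷ [] , 0F ∷ []) ∷ (-1ₛ , 3F ∷ 1F ∷ [] , 0F ∷ []) ∷ [] )
    ∷ ( (0ₛ  , 0F ∷ 1F ∷ [] , 0F ∷ []) ∷ (0ₛ  , 3F ∷ 1F ∷ [] , 0F ∷ []) ∷ (0ₛ  , 3F ∷ 0F ∷ [] , 0F ∷ []) ∷ (0ₛ  , 2F ∷ 2F ∷ [] , 0F ∷ []) ∷ [] )
    ∷ [] )
  ∷ ( ( (0ₛ  , 3F ∷ 2F ∷ [] , 1F ∷ []) ∷ (+1ₛ , 2F ∷ 1F ∷ [] , 1F ∷ []) ∷ (-1ₛ , 2F ∷ 3F ∷ [] , 1F ∷ []) ∷ (0ₛ  , 1F ∷ 2F ∷ [] , 1F ∷ []) ∷ [] )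
    ∷ ( (+1ₛ , 0F ∷ 2F ∷ [] , 1F ∷ []) ∷ (-1ₛ , 3F ∷ 0F ∷ [] , 0F ∷ []) ∷ (+1ₛ , 0F ∷ 2F ∷ [] , 0F ∷ []) ∷ (-1ₛ , 1F ∷ 0F ∷ [] , 1F ∷ []) ∷ [] )
    ∷ ( (-1ₛ , 1F ∷ 0F ∷ [] , 0F ∷ []) ∷ (0ₛ  , 3F ∷ 3F ∷ [] , 1F ∷ []) ∷ (0ₛ  , 2F ∷ 3F ∷ [] , 1F ∷ []) ∷ (+1ₛ , 2F ∷ 2F ∷ [] , 0F ∷ []) ∷ [] )
    ∷ [] )
  ∷ ( ( (+1ₛ , 2F ∷ 2F ∷ [] , 1F ∷ []) ∷ (-1ₛ , 1F ∷ 2F ∷ [] , 1F ∷ []) ∷ (-1ₛ , 3F ∷ 3F ∷ [] , 0F ∷ []) ∷ (+1ₛ , 2F ∷ 1F ∷ [] , 0F ∷ []) ∷ [] )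
    ∷ ( (-1ₛ , 0F ∷ 2F ∷ [] , 0F ∷ []) ∷ (+1ₛ , 2F ∷ 3F ∷ [] , 0F ∷ []) ∷ (0ₛ  , 0F ∷ 2F ∷ [] , 1F ∷ []) ∷ (0ₛ  , 2F ∷ 1F ∷ [] , 1F ∷ []) ∷ [] )
    ∷ ( (0ₛ  , 2F ∷ 0F ∷ [] , 1F ∷ []) ∷ (0ₛ  , 1F ∷ 3F ∷ [] , 1F ∷ []) ∷ (+1ₛ , 1F ∷ 3F ∷ [] , 1F ∷ []) ∷ (-1ₛ , 0F ∷ 2F ∷ [] , 1F ∷ []) ∷ [] )
    ∷ [] )
  ∷ ( ( (+1ₛ , 0F ∷ 0F ∷ [] , 0F ∷ []) ∷ (+1ₛ , 1F ∷ 1F ∷ [] , 1F ∷ []) ∷ (-1ₛ , 3F ∷ 2F ∷ [] , 0F ∷ []) ∷ (-1ₛ , 0F ∷ 1F ∷ [] , 1F ∷ []) ∷ [] )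
    ∷ ( (-1ₛ , 0F ∷ 0F ∷ [] , 1F ∷ []) ∷ (0ₛ  , 1F ∷ 3F ∷ [] , 0F ∷ []) ∷ (+1ₛ , 2F ∷ 0F ∷ [] , 0F ∷ []) ∷ (0ₛ  , 1F ∷ 1F ∷ [] , 1F ∷ []) ∷ [] )
    ∷ ( (0ₛ  , 0F ∷ 0F ∷ [] , 1F ∷ []) ∷ (-1ₛ , 2F ∷ 0F ∷ [] , 1F ∷ []) ∷ (0ₛ  , 3F ∷ 2F ∷ [] , 0F ∷ []) ∷ (+1ₛ , 3F ∷ 2F ∷ [] , 0F ∷ []) ∷ [] )
    ∷ [] )
  ∷ [] )
  ( ( (0F ∷ 0F ∷ [] , 0F ∷ []) ∷ (2F ∷ 0F ∷ [] , 0F ∷ []) ∷ (0F ∷ 2F ∷ [] , 0F ∷ []) ∷ (2F ∷ 2F ∷ [] , 0F ∷ []) ∷ [] )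
  ∷ ( (0F ∷ 0F ∷ [] , 1F ∷ []) ∷ (2F ∷ 2F ∷ [] , 1F ∷ []) ∷ (2F ∷ 0F ∷ [] , 1F ∷ []) ∷ (0F ∷ 2F ∷ [] , 1F ∷ []) ∷ [] )
  ∷ ( (0F ∷ 1F ∷ [] , 0F ∷ []) ∷ (0F ∷ 3F ∷ [] , 0F ∷ []) ∷ (2F ∷ 1F ∷ [] , 0F ∷ []) ∷ (2F ∷ 3F ∷ [] , 0F ∷ []) ∷ [] )
  ∷ ( (0F ∷ 1F ∷ [] , 1F ∷ []) ∷ (0F ∷ 3F ∷ [] , 1F ∷ []) ∷ (2F ∷ 1F ∷ [] , 1F ∷ []) ∷ (2F ∷ 3F ∷ [] , 1F ∷ []) ∷ [] )
  ∷ ( (1F ∷ 0F ∷ [] , 0F ∷ []) ∷ (3F ∷ 0F ∷ [] , 0F ∷ []) ∷ (1F ∷ 2F ∷ [] , 0F ∷ []) ∷ (3F ∷ 2F ∷ [] , 0F ∷ []) ∷ [] )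
  ∷ ( (1F ∷ 0F ∷ [] , 1F ∷ []) ∷ (3F ∷ 0F ∷ [] , 1F ∷ []) ∷ (1F ∷ 2F ∷ [] , 1F ∷ []) ∷ (3F ∷ 2F ∷ [] , 1F ∷ []) ∷ [] )
  ∷ ( (1F ∷ 1F ∷ [] , 0F ∷ []) ∷ (3F ∷ 3F ∷ [] , 0F ∷ []) ∷ (3F ∷ 1F ∷ [] , 0F ∷ []) ∷ (1F ∷ 3F ∷ [] , 0F ∷ []) ∷ [] )
  ∷ ( (1F ∷ 1F ∷ [] , 1F ∷ []) ∷ (3F ∷ 3F ∷ [] , 1F ∷ []) ∷ (3F ∷ 1F ∷ [] , 1F ∷ []) ∷ (1F ∷ 3F ∷ [] , 1F ∷ []) ∷ [] )
  ∷ [] )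

core-ℤ₄³ : Core 1 (S₂ᴳ 3 0)
core-ℤ₄³ = S₂-BySearch.core-by-search 3 0
  ( ( ( (0ₛ  , 2F ∷ 1F ∷ 3F ∷ [] , []) ∷ (0ₛ  , 1F ∷ 1F ∷ 2F ∷ [] , []) ∷ (0ₛ  , 1F ∷ 2F ∷ 3F ∷ [] , []) ∷ (0ₛ  , 0F ∷ 0F ∷ 0F ∷ [] , []) ∷ [] )
    ∷ ( (-1ₛ , 0F ∷ 1F ∷ 2F ∷ [] , []) ∷ (+1ₛ , 3F ∷ 2F ∷ 1F ∷ [] , []) ∷ (-1ₛ , 2F ∷ 1F ∷ 0F ∷ [] , []) ∷ (+1ₛ , 3F ∷ 0F ∷ 1F ∷ [] , []) ∷ [] )
    ∷ ( (+1ₛ , 2F ∷ 2F ∷ 3F ∷ [] , []) ∷ (-1ₛ , 0F ∷ 1F ∷ 1F ∷ [] , []) ∷ (+1ₛ , 1F ∷ 1F ∷ 1F ∷ [] , []) ∷ (-1ₛ , 1F ∷ 0F ∷ 3F ∷ [] , []) ∷ [] )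
    ∷ [] )
  ∷ ( ( (+1ₛ , 0F ∷ 0F ∷ 2F ∷ [] , []) ∷ (-1ₛ , 3F ∷ 1F ∷ 2F ∷ [] , []) ∷ (+1ₛ , 2F ∷ 1F ∷ 2F ∷ [] , []) ∷ (-1ₛ , 3F ∷ 2F ∷ 2F ∷ [] , []) ∷ [] )
    ∷ ( (-1ₛ , 0F ∷ 3F ∷ 3F ∷ [] , []) ∷ (+1ₛ , 0F ∷ 2F ∷ 1F ∷ [] , []) ∷ (0ₛ  , 2F ∷ 2F ∷ 2F ∷ [] , []) ∷ (0ₛ  , 2F ∷ 1F ∷ 2F ∷ [] , []) ∷ [] )
    ∷ ( (0ₛ  , 0F ∷ 1F ∷ 3F ∷ [] , []) ∷ (0ₛ  , 1F ∷ 1F ∷ 1F ∷ [] , []) ∷ (-1ₛ , 0F ∷ 1F ∷ 0F ∷ [] , []) ∷ (+1ₛ , 3F ∷ 1F ∷ 0F ∷ [] , []) ∷ [] )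
    ∷ [] )
  ∷ ( ( (+1ₛ , 2F ∷ 1F ∷ 1F ∷ [] , []) ∷ (-1ₛ , 2F ∷ 3F ∷ 1F ∷ [] , []) ∷ (0ₛ  , 3F ∷ 2F ∷ 2F ∷ [] , []) ∷ (0ₛ  , 1F ∷ 2F ∷ 0F ∷ [] , []) ∷ [] )
    ∷ ( (-1ₛ , 0F ∷ 1F ∷ 3F ∷ [] , []) ∷ (+1ₛ , 3F ∷ 3F ∷ 3F ∷ [] , []) ∷ (-1ₛ , 1F ∷ 1F ∷ 1F ∷ [] , []) ∷ (+1ₛ , 0F ∷ 3F ∷ 1F ∷ [] , []) ∷ [] )
    ∷ ( (0ₛ  , 2F ∷ 2F ∷ 0F ∷ [] , []) ∷ (0ₛ  , 3F ∷ 2F ∷ 0F ∷ [] , []) ∷ (+1ₛ , 0F ∷ 1F ∷ 1F ∷ [] , []) ∷ (-1ₛ , 3F ∷ 3F ∷ 3F ∷ [] , []) ∷ [] )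
    ∷ [] )
  ∷ ( ( (0ₛ  , 0F ∷ 1F ∷ 1F ∷ [] , []) ∷ (0ₛ  , 2F ∷ 0F ∷ 3F ∷ [] , []) ∷ (-1ₛ , 3F ∷ 1F ∷ 0F ∷ [] , []) ∷ (+1ₛ , 3F ∷ 2F ∷ 0F ∷ [] , []) ∷ [] )
    ∷ ( (+1ₛ , 2F ∷ 0F ∷ 1F ∷ [] , []) ∷ (-1ₛ , 0F ∷ 3F ∷ 1F ∷ [] , []) ∷ (0ₛ  , 1F ∷ 2F ∷ 2F ∷ [] , []) ∷ (0ₛ  , 1F ∷ 3F ∷ 0F ∷ [] , []) ∷ [] )
    ∷ ( (-1ₛ , 2F ∷ 3F ∷ 2F ∷ [] , []) ∷ (+1ₛ , 2F ∷ 1F ∷ 0F ∷ [] , []) ∷ (+1ₛ , 0F ∷ 1F ∷ 2F ∷ [] , []) ∷ (-1ₛ , 0F ∷ 3F ∷ 0F ∷ [] , []) ∷ [] )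
    ∷ [] )
  ∷ ( ( (+1ₛ , 1F ∷ 1F ∷ 0F ∷ [] , []) ∷ (-1ₛ , 1F ∷ 0F ∷ 1F ∷ [] , []) ∷ (+1ₛ , 1F ∷ 3F ∷ 1F ∷ [] , []) ∷ (-1ₛ , 1F ∷ 0F ∷ 2F ∷ [] , []) ∷ [] )
    ∷ ( (-1ₛ , 1F ∷ 3F ∷ 3F ∷ [] , []) ∷ (+1ₛ , 2F ∷ 0F ∷ 3F ∷ [] , []) ∷ (0ₛ  , 1F ∷ 3F ∷ 2F ∷ [] , []) ∷ (0ₛ  , 0F ∷ 2F ∷ 0F ∷ [] , []) ∷ [] )
    ∷ ( (0ₛ  , 2F ∷ 0F ∷ 1F ∷ [] , []) ∷ (0ₛ  , 1F ∷ 0F ∷ 0F ∷ [] , []) ∷ (-1ₛ , 2F ∷ 2F ∷ 1F ∷ [] , []) ∷ (+1ₛ , 3F ∷ 2F ∷ 2F ∷ [] , []) ∷ [] )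
    ∷ [] )
  ∷ ( ( (+1ₛ , 0F ∷ 0F ∷ 1F ∷ [] , []) ∷ (-1ₛ , 3F ∷ 3F ∷ 0F ∷ [] , []) ∷ (0ₛ  , 2F ∷ 2F ∷ 3F ∷ [] , []) ∷ (0ₛ  , 3F ∷ 3F ∷ 0F ∷ [] , []) ∷ [] )
    ∷ ( (-1ₛ , 1F ∷ 2F ∷ 2F ∷ [] , []) ∷ (+1ₛ , 1F ∷ 2F ∷ 2F ∷ [] , []) ∷ (-1ₛ , 3F ∷ 1F ∷ 3F ∷ [] , []) ∷ (+1ₛ , 3F ∷ 3F ∷ 1F ∷ [] , []) ∷ [] )
    ∷ ( (0ₛ  , 3F ∷ 2F ∷ 1F ∷ [] , []) ∷ (0ₛ  , 0F ∷ 3F ∷ 2F ∷ [] , []) ∷ (+1ₛ , 3F ∷ 1F ∷ 2F ∷ [] , []) ∷ (-1ₛ , 2F ∷ 2F ∷ 3F ∷ [] , []) ∷ [] )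
    ∷ [] )
  ∷ ( ( (0ₛ  , 0F ∷ 2F ∷ 3F ∷ [] , []) ∷ (0ₛ  , 0F ∷ 2F ∷ 1F ∷ [] , []) ∷ (0ₛ  , 2F ∷ 1F ∷ 1F ∷ [] , []) ∷ (0ₛ  , 2F ∷ 3F ∷ 3F ∷ [] , []) ∷ [] )
    ∷ ( (+1ₛ , 2F ∷ 2F ∷ 1F ∷ [] , []) ∷ (-1ₛ , 1F ∷ 3F ∷ 1F ∷ [] , []) ∷ (+1ₛ , 2F ∷ 3F ∷ 0F ∷ [] , []) ∷ (-1ₛ , 3F ∷ 0F ∷ 2F ∷ [] , []) ∷ [] )
    ∷ ( (-1ₛ , 2F ∷ 0F ∷ 0F ∷ [] , []) ∷ (+1ₛ , 3F ∷ 3F ∷ 2F ∷ [] , []) ∷ (-1ₛ , 0F ∷ 0F ∷ 3F ∷ [] , []) ∷ (+1ₛ , 3F ∷ 1F ∷ 3F ∷ [] , []) ∷ [] )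
    ∷ [] )
  ∷ ( ( (+1ₛ , 0F ∷ 0F ∷ 0F ∷ [] , []) ∷ (-1ₛ , 0F ∷ 0F ∷ 2F ∷ [] , []) ∷ (0ₛ  , 2F ∷ 1F ∷ 0F ∷ [] , []) ∷ (0ₛ  , 2F ∷ 3F ∷ 2F ∷ [] , []) ∷ [] )
    ∷ ( (-1ₛ , 1F ∷ 2F ∷ 1F ∷ [] , []) ∷ (+1ₛ , 1F ∷ 0F ∷ 1F ∷ [] , []) ∷ (+1ₛ , 1F ∷ 0F ∷ 2F ∷ [] , []) ∷ (-1ₛ , 1F ∷ 2F ∷ 0F ∷ [] , []) ∷ [] )
    ∷ ( (0ₛ  , 3F ∷ 2F ∷ 3F ∷ [] , []) ∷ (0ₛ  , 3F ∷ 0F ∷ 1F ∷ [] , []) ∷ (-1ₛ , 1F ∷ 3F ∷ 2F ∷ [] , []) ∷ (+1ₛ , 1F ∷ 3F ∷ 2F ∷ [] , []) ∷ [] )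
    ∷ [] )
  ∷ ( ( (-1ₛ , 2F ∷ 1F ∷ 1F ∷ [] , []) ∷ (+1ₛ , 3F ∷ 0F ∷ 3F ∷ [] , []) ∷ (-1ₛ , 0F ∷ 3F ∷ 2F ∷ [] , []) ∷ (+1ₛ , 3F ∷ 0F ∷ 2F ∷ [] , []) ∷ [] )
    ∷ ( (0ₛ  , 0F ∷ 3F ∷ 3F ∷ [] , []) ∷ (-1ₛ , 3F ∷ 0F ∷ 1F ∷ [] , []) ∷ (+1ₛ , 1F ∷ 1F ∷ 2F ∷ [] , []) ∷ (0ₛ  , 0F ∷ 0F ∷ 2F ∷ [] , []) ∷ [] )
    ∷ ( (+1ₛ , 2F ∷ 0F ∷ 0F ∷ [] , []) ∷ (0ₛ  , 2F ∷ 0F ∷ 0F ∷ [] , []) ∷ (0ₛ  , 3F ∷ 0F ∷ 0F ∷ [] , []) ∷ (-1ₛ , 1F ∷ 0F ∷ 0F ∷ [] , []) ∷ [] )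
    ∷ [] )
  ∷ ( ( (+1ₛ , 0F ∷ 1F ∷ 0F ∷ [] , []) ∷ (+1ₛ , 0F ∷ 3F ∷ 0F ∷ [] , []) ∷ (-1ₛ , 1F ∷ 1F ∷ 2F ∷ [] , []) ∷ (-1ₛ , 3F ∷ 3F ∷ 2F ∷ [] , []) ∷ [] )
    ∷ ( (0ₛ  , 2F ∷ 3F ∷ 1F ∷ [] , []) ∷ (-1ₛ , 2F ∷ 2F ∷ 0F ∷ [] , []) ∷ (0ₛ  , 3F ∷ 3F ∷ 3F ∷ [] , []) ∷ (+1ₛ , 1F ∷ 0F ∷ 0F ∷ [] , []) ∷ [] )
    ∷ ( (-1ₛ , 2F ∷ 0F ∷ 3F ∷ [] , []) ∷ (0ₛ  , 2F ∷ 3F ∷ 0F ∷ [] , []) ∷ (+1ₛ , 0F ∷ 0F ∷ 3F ∷ [] , []) ∷ (0ₛ  , 0F ∷ 1F ∷ 2F ∷ [] , []) ∷ [] )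
    ∷ [] )
  ∷ ( ( (0ₛ  , 3F ∷ 1F ∷ 0F ∷ [] , []) ∷ (0ₛ  , 3F ∷ 0F ∷ 3F ∷ [] , []) ∷ (-1ₛ , 3F ∷ 2F ∷ 0F ∷ [] , []) ∷ (+1ₛ , 3F ∷ 1F ∷ 1F ∷ [] , []) ∷ [] )
    ∷ ( (-1ₛ , 1F ∷ 1F ∷ 0F ∷ [] , []) ∷ (+1ₛ , 2F ∷ 2F ∷ 0F ∷ [] , []) ∷ (0ₛ  , 0F ∷ 0F ∷ 1F ∷ [] , []) ∷ (0ₛ  , 1F ∷ 1F ∷ 3F ∷ [] , []) ∷ [] )
    ∷ ( (+1ₛ , 0F ∷ 2F ∷ 0F ∷ [] , []) ∷ (-1ₛ , 3F ∷ 2F ∷ 1F ∷ [] , []) ∷ (+1ₛ , 1F ∷ 2F ∷ 3F ∷ [] , []) ∷ (-1ₛ , 0F ∷ 2F ∷ 0F ∷ [] , []) ∷ [] )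
    ∷ [] )
  ∷ ( ( (+1ₛ , 0F ∷ 1F ∷ 3F ∷ [] , []) ∷ (0ₛ  , 3F ∷ 1F ∷ 1F ∷ [] , []) ∷ (-1ₛ , 3F ∷ 0F ∷ 3F ∷ [] , []) ∷ (0ₛ  , 2F ∷ 2F ∷ 1F ∷ [] , []) ∷ [] )
    ∷ ( (-1ₛ , 0F ∷ 0F ∷ 1F ∷ [] , []) ∷ (-1ₛ , 3F ∷ 1F ∷ 1F ∷ [] , []) ∷ (+1ₛ , 2F ∷ 3F ∷ 2F ∷ [] , []) ∷ (+1ₛ , 3F ∷ 0F ∷ 0F ∷ [] , []) ∷ [] )
    ∷ ( (0ₛ  , 0F ∷ 3F ∷ 0F ∷ [] , []) ∷ (+1ₛ , 2F ∷ 2F ∷ 2F ∷ [] , []) ∷ (0ₛ  , 3F ∷ 1F ∷ 3F ∷ [] , []) ∷ (-1ₛ , 3F ∷ 2F ∷ 3F ∷ [] , []) ∷ [] )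
    ∷ [] )
  ∷ ( ( (0ₛ  , 3F ∷ 3F ∷ 1F ∷ [] , []) ∷ (0ₛ  , 1F ∷ 0F ∷ 3F ∷ [] , []) ∷ (0ₛ  , 1F ∷ 0F ∷ 2F ∷ [] , []) ∷ (0ₛ  , 3F ∷ 1F ∷ 2F ∷ [] , []) ∷ [] )
    ∷ ( (+1ₛ , 0F ∷ 2F ∷ 3F ∷ [] , []) ∷ (-1ₛ , 0F ∷ 2F ∷ 2F ∷ [] , []) ∷ (-1ₛ , 1F ∷ 1F ∷ 3F ∷ [] , []) ∷ (+1ₛ , 3F ∷ 3F ∷ 0F ∷ [] , []) ∷ [] )
    ∷ ( (-1ₛ , 1F ∷ 3F ∷ 0F ∷ [] , []) ∷ (+1ₛ , 3F ∷ 2F ∷ 3F ∷ [] , []) ∷ (+1ₛ , 2F ∷ 3F ∷ 3F ∷ [] , []) ∷ (-1ₛ , 2F ∷ 0F ∷ 2F ∷ [] , []) ∷ [] )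
    ∷ [] )
  ∷ ( ( (-1ₛ , 3F ∷ 3F ∷ 1F ∷ [] , []) ∷ (+1ₛ , 1F ∷ 0F ∷ 3F ∷ [] , []) ∷ (-1ₛ , 2F ∷ 0F ∷ 1F ∷ [] , []) ∷ (+1ₛ , 2F ∷ 1F ∷ 3F ∷ [] , []) ∷ [] )
    ∷ ( (0ₛ  , 1F ∷ 2F ∷ 1F ∷ [] , []) ∷ (-1ₛ , 2F ∷ 1F ∷ 2F ∷ [] , []) ∷ (+1ₛ , 1F ∷ 3F ∷ 3F ∷ [] , []) ∷ (0ₛ  , 0F ∷ 2F ∷ 2F ∷ [] , []) ∷ [] )
    ∷ ( (+1ₛ , 0F ∷ 3F ∷ 2F ∷ [] , []) ∷ (0ₛ  , 1F ∷ 3F ∷ 3F ∷ [] , []) ∷ (0ₛ  , 1F ∷ 1F ∷ 0F ∷ [] , []) ∷ (-1ₛ , 2F ∷ 1F ∷ 3F ∷ [] , []) ∷ [] )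
    ∷ [] )
  ∷ ( ( (+1ₛ , 1F ∷ 1F ∷ 3F ∷ [] , []) ∷ (-1ₛ , 3F ∷ 0F ∷ 0F ∷ [] , []) ∷ (-1ₛ , 2F ∷ 3F ∷ 3F ∷ [] , []) ∷ (+1ₛ , 2F ∷ 0F ∷ 2F ∷ [] , []) ∷ [] )
    ∷ ( (-1ₛ , 2F ∷ 3F ∷ 0F ∷ [] , []) ∷ (+1ₛ , 1F ∷ 3F ∷ 0F ∷ [] , []) ∷ (+1ₛ , 1F ∷ 2F ∷ 0F ∷ [] , []) ∷ (-1ₛ , 0F ∷ 0F ∷ 0F ∷ [] , []) ∷ [] )
    ∷ ( (0ₛ  , 1F ∷ 0F ∷ 1F ∷ [] , []) ∷ (0ₛ  , 0F ∷ 1F ∷ 0F ∷ [] , []) ∷ (0ₛ  , 1F ∷ 3F ∷ 1F ∷ [] , []) ∷ (0ₛ  , 2F ∷ 0F ∷ 2F ∷ [] , []) ∷ [] )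
    ∷ [] )
  ∷ ( ( (-1ₛ , 0F ∷ 2F ∷ 3F ∷ [] , []) ∷ (+1ₛ , 2F ∷ 3F ∷ 1F ∷ [] , []) ∷ (0ₛ  , 3F ∷ 3F ∷ 2F ∷ [] , []) ∷ (0ₛ  , 3F ∷ 0F ∷ 2F ∷ [] , []) ∷ [] )
    ∷ ( (+1ₛ , 0F ∷ 2F ∷ 2F ∷ [] , []) ∷ (-1ₛ , 2F ∷ 2F ∷ 2F ∷ [] , []) ∷ (-1ₛ , 1F ∷ 2F ∷ 3F ∷ [] , []) ∷ (+1ₛ , 1F ∷ 2F ∷ 1F ∷ [] , []) ∷ [] )
    ∷ ( (0ₛ  , 0F ∷ 0F ∷ 3F ∷ [] , []) ∷ (0ₛ  , 0F ∷ 3F ∷ 1F ∷ [] , []) ∷ (+1ₛ , 0F ∷ 3F ∷ 3F ∷ [] , []) ∷ (-1ₛ , 0F ∷ 2F ∷ 1F ∷ [] , []) ∷ [] )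
    ∷ [] )
  ∷ [] )
  ( ( (0F ∷ 0F ∷ 0F ∷ [] , []) ∷ (2F ∷ 0F ∷ 0F ∷ [] , []) ∷ (0F ∷ 2F ∷ 0F ∷ [] , []) ∷ (2F ∷ 2F ∷ 0F ∷ [] , []) ∷ [] )
  ∷ ( (0F ∷ 0F ∷ 1F ∷ [] , []) ∷ (2F ∷ 2F ∷ 1F ∷ [] , []) ∷ (2F ∷ 0F ∷ 1F ∷ [] , []) ∷ (0F ∷ 2F ∷ 1F ∷ [] , []) ∷ [] )
  ∷ ( (0F ∷ 0F ∷ 2F ∷ [] , []) ∷ (2F ∷ 0F ∷ 2F ∷ [] , []) ∷ (0F ∷ 2F ∷ 2F ∷ [] , []) ∷ (2F ∷ 2F ∷ 2F ∷ [] , []) ∷ [] )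
  ∷ ( (0F ∷ 0F ∷ 3F ∷ [] , []) ∷ (2F ∷ 2F ∷ 3F ∷ [] , []) ∷ (2F ∷ 0F ∷ 3F ∷ [] , []) ∷ (0F ∷ 2F ∷ 3F ∷ [] , []) ∷ [] )
  ∷ ( (0F ∷ 1F ∷ 0F ∷ [] , []) ∷ (0F ∷ 3F ∷ 0F ∷ [] , []) ∷ (2F ∷ 1F ∷ 0F ∷ [] , []) ∷ (2F ∷ 3F ∷ 0F ∷ [] , []) ∷ [] )
  ∷ ( (0F ∷ 1F ∷ 1F ∷ [] , []) ∷ (2F ∷ 1F ∷ 1F ∷ [] , []) ∷ (0F ∷ 3F ∷ 1F ∷ [] , []) ∷ (2F ∷ 3F ∷ 1F ∷ [] , []) ∷ [] )
  ∷ ( (0F ∷ 1F ∷ 2F ∷ [] , []) ∷ (0F ∷ 3F ∷ 2F ∷ [] , []) ∷ (2F ∷ 1F ∷ 2F ∷ [] , []) ∷ (2F ∷ 3F ∷ 2F ∷ [] , []) ∷ [] )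
  ∷ ( (0F ∷ 3F ∷ 3F ∷ [] , []) ∷ (2F ∷ 3F ∷ 3F ∷ [] , []) ∷ (0F ∷ 1F ∷ 3F ∷ [] , []) ∷ (2F ∷ 1F ∷ 3F ∷ [] , []) ∷ [] )
  ∷ ( (1F ∷ 0F ∷ 0F ∷ [] , []) ∷ (3F ∷ 0F ∷ 0F ∷ [] , []) ∷ (1F ∷ 2F ∷ 0F ∷ [] , []) ∷ (3F ∷ 2F ∷ 0F ∷ [] , []) ∷ [] )
  ∷ ( (1F ∷ 0F ∷ 1F ∷ [] , []) ∷ (3F ∷ 2F ∷ 1F ∷ [] , []) ∷ (3F ∷ 0F ∷ 1F ∷ [] , []) ∷ (1F ∷ 2F ∷ 1F ∷ [] , []) ∷ [] )
  ∷ ( (1F ∷ 0F ∷ 2F ∷ [] , []) ∷ (3F ∷ 0F ∷ 2F ∷ [] , []) ∷ (1F ∷ 2F ∷ 2F ∷ [] , []) ∷ (3F ∷ 2F ∷ 2F ∷ [] , []) ∷ [] )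
  ∷ ( (3F ∷ 0F ∷ 3F ∷ [] , []) ∷ (1F ∷ 2F ∷ 3F ∷ [] , []) ∷ (1F ∷ 0F ∷ 3F ∷ [] , []) ∷ (3F ∷ 2F ∷ 3F ∷ [] , []) ∷ [] )
  ∷ ( (1F ∷ 1F ∷ 0F ∷ [] , []) ∷ (3F ∷ 3F ∷ 0F ∷ [] , []) ∷ (3F ∷ 1F ∷ 0F ∷ [] , []) ∷ (1F ∷ 3F ∷ 0F ∷ [] , []) ∷ [] )
  ∷ ( (1F ∷ 1F ∷ 1F ∷ [] , []) ∷ (3F ∷ 3F ∷ 1F ∷ [] , []) ∷ (3F ∷ 1F ∷ 1F ∷ [] , []) ∷ (1F ∷ 3F ∷ 1F ∷ [] , []) ∷ [] )
  ∷ ( (1F ∷ 1F ∷ 2F ∷ [] , []) ∷ (3F ∷ 3F ∷ 2F ∷ [] , []) ∷ (3F ∷ 1F ∷ 2F ∷ [] , []) ∷ (1F ∷ 3F ∷ 2F ∷ [] , []) ∷ [] )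
  ∷ ( (1F ∷ 1F ∷ 3F ∷ [] , []) ∷ (3F ∷ 3F ∷ 3F ∷ [] , []) ∷ (3F ∷ 1F ∷ 3F ∷ [] , []) ∷ (1F ∷ 3F ∷ 3F ∷ [] , []) ∷ [] )
  ∷ [] )

core-ℤ₂² : Core 2 (S₂ᴳ 0 2)
core-ℤ₂² = S₂-BySearch.core-by-search 0 2
  ( ( ( (-2ₛ , [] , 1F ∷ 0F ∷ []) ∷ (+1ₛ , [] , 1F ∷ 1F ∷ []) ∷ (-1ₛ , [] , 1F ∷ 1F ∷ []) ∷ (+2ₛ , [] , 1F ∷ 0F ∷ []) ∷ [] )
    ∷ ( (-2ₛ , [] , 0F ∷ 0F ∷ []) ∷ (0ₛ  , [] , 1F ∷ 1F ∷ []) ∷ (+2ₛ , [] , 0F ∷ 1F ∷ []) ∷ (0ₛ  , [] , 1F ∷ 0F ∷ []) ∷ [] )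
    ∷ ( (+1ₛ , [] , 0F ∷ 0F ∷ []) ∷ (+2ₛ , [] , 1F ∷ 1F ∷ []) ∷ (-1ₛ , [] , 1F ∷ 0F ∷ []) ∷ (-2ₛ , [] , 0F ∷ 1F ∷ []) ∷ [] )
    ∷ ( (+2ₛ , [] , 0F ∷ 0F ∷ []) ∷ (-1ₛ , [] , 0F ∷ 0F ∷ []) ∷ (-1ₛ , [] , 0F ∷ 1F ∷ []) ∷ (0ₛ  , [] , 0F ∷ 1F ∷ []) ∷ [] )
    ∷ ( (+1ₛ , [] , 1F ∷ 0F ∷ []) ∷ (-2ₛ , [] , 1F ∷ 1F ∷ []) ∷ (+1ₛ , [] , 0F ∷ 1F ∷ []) ∷ (0ₛ  , [] , 0F ∷ 0F ∷ []) ∷ [] )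
    ∷ [] )
  ∷ [] )
  ( ( ([] , 0F ∷ 0F ∷ []) ∷ ([] , 1F ∷ 0F ∷ []) ∷ ([] , 0F ∷ 1F ∷ []) ∷ ([] , 1F ∷ 1F ∷ []) ∷ [] )
  ∷ [] )

core-ℤ₂³ : Core 2 (S₂ᴳ 0 3)
core-ℤ₂³ = S₂-BySearch.core-by-search 0 3
  ( ( ( (-2ₛ , [] , 0F ∷ 0F ∷ 0F ∷ []) ∷ (0ₛ  , [] , 1F ∷ 0F ∷ 1F ∷ []) ∷ (0ₛ  , [] , 0F ∷ 1F ∷ 0F ∷ []) ∷ (+2ₛ , [] , 1F ∷ 1F ∷ 1F ∷ []) ∷ [] )
    ∷ ( (-1ₛ , [] , 1F ∷ 0F ∷ 0F ∷ []) ∷ (+2ₛ , [] , 1F ∷ 0F ∷ 1F ∷ []) ∷ (-2ₛ , [] , 0F ∷ 1F ∷ 1F ∷ []) ∷ (+1ₛ , [] , 0F ∷ 1F ∷ 0F ∷ []) ∷ [] )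
    ∷ ( (+1ₛ , [] , 1F ∷ 1F ∷ 1F ∷ []) ∷ (+2ₛ , [] , 1F ∷ 1F ∷ 0F ∷ []) ∷ (-1ₛ , [] , 0F ∷ 0F ∷ 0F ∷ []) ∷ (-2ₛ , [] , 0F ∷ 0F ∷ 1F ∷ []) ∷ [] )
    ∷ ( (0ₛ  , [] , 0F ∷ 0F ∷ 1F ∷ []) ∷ (-2ₛ , [] , 0F ∷ 1F ∷ 0F ∷ []) ∷ (+1ₛ , [] , 0F ∷ 0F ∷ 0F ∷ []) ∷ (+1ₛ , [] , 0F ∷ 1F ∷ 1F ∷ []) ∷ [] )
    ∷ ( (+2ₛ , [] , 0F ∷ 1F ∷ 0F ∷ []) ∷ (-2ₛ , [] , 1F ∷ 0F ∷ 0F ∷ []) ∷ (+2ₛ , [] , 0F ∷ 0F ∷ 1F ∷ []) ∷ (-2ₛ , [] , 1F ∷ 1F ∷ 1F ∷ []) ∷ [] )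
    ∷ [] )
  ∷ ( ( (0ₛ  , [] , 1F ∷ 1F ∷ 1F ∷ []) ∷ (0ₛ  , [] , 1F ∷ 0F ∷ 0F ∷ []) ∷ (+1ₛ , [] , 1F ∷ 0F ∷ 0F ∷ []) ∷ (-1ₛ , [] , 1F ∷ 1F ∷ 1F ∷ []) ∷ [] )
    ∷ ( (0ₛ  , [] , 0F ∷ 1F ∷ 1F ∷ []) ∷ (+1ₛ , [] , 0F ∷ 0F ∷ 1F ∷ []) ∷ (-1ₛ , [] , 0F ∷ 1F ∷ 0F ∷ []) ∷ (0ₛ  , [] , 0F ∷ 0F ∷ 0F ∷ []) ∷ [] )
    ∷ ( (+2ₛ , [] , 0F ∷ 0F ∷ 0F ∷ []) ∷ (-2ₛ , [] , 1F ∷ 1F ∷ 0F ∷ []) ∷ (+2ₛ , [] , 0F ∷ 1F ∷ 1F ∷ []) ∷ (-2ₛ , [] , 1F ∷ 0F ∷ 1F ∷ []) ∷ [] )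
    ∷ ( (-1ₛ , [] , 0F ∷ 0F ∷ 1F ∷ []) ∷ (0ₛ  , [] , 1F ∷ 1F ∷ 0F ∷ []) ∷ (-1ₛ , [] , 0F ∷ 1F ∷ 1F ∷ []) ∷ (+2ₛ , [] , 1F ∷ 0F ∷ 0F ∷ []) ∷ [] )
    ∷ ( (-1ₛ , [] , 1F ∷ 0F ∷ 1F ∷ []) ∷ (+1ₛ , [] , 1F ∷ 0F ∷ 1F ∷ []) ∷ (-1ₛ , [] , 1F ∷ 1F ∷ 0F ∷ []) ∷ (+1ₛ , [] , 1F ∷ 1F ∷ 0F ∷ []) ∷ [] )
    ∷ [] )
  ∷ [] )
  ( ( ([] , 0F ∷ 0F ∷ 0F ∷ []) ∷ ([] , 1F ∷ 0F ∷ 0F ∷ []) ∷ ([] , 0F ∷ 1F ∷ 0F ∷ []) ∷ ([] , 1F ∷ 1F ∷ 0F ∷ []) ∷ [] )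
  ∷ ( ([] , 0F ∷ 0F ∷ 1F ∷ []) ∷ ([] , 1F ∷ 1F ∷ 1F ∷ []) ∷ ([] , 1F ∷ 0F ∷ 1F ∷ []) ∷ ([] , 0F ∷ 1F ∷ 1F ∷ []) ∷ [] )
  ∷ [] )

mrs-ℤ₃×ℤ₂² : MRS* (≡-AbelianGroup.abelianGroup (ZpS2ᴳ 3 0 2)) 3 4 1
mrs-ℤ₃×ℤ₂² = ZpS2-BySearch.mrs*-by-search 2 0 2
  ( ( ( (1F , [] , 0F ∷ 0F ∷ []) ∷ (0F , [] , 1F ∷ 1F ∷ []) ∷ (1F , [] , 1F ∷ 0F ∷ []) ∷ (1F , [] , 0F ∷ 1F ∷ []) ∷ [] )
    ∷ ( (2F , [] , 1F ∷ 0F ∷ []) ∷ (1F , [] , 1F ∷ 1F ∷ []) ∷ (0F , [] , 0F ∷ 1F ∷ []) ∷ (0F , [] , 0F ∷ 0F ∷ []) ∷ [] )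
    ∷ ( (0F , [] , 1F ∷ 0F ∷ []) ∷ (2F , [] , 0F ∷ 0F ∷ []) ∷ (2F , [] , 1F ∷ 1F ∷ []) ∷ (2F , [] , 0F ∷ 1F ∷ []) ∷ [] )
    ∷ [] )
  ∷ [] )

mrs-ℤ₃×ℤ₂³ : MRS* (≡-AbelianGroup.abelianGroup (ZpS2ᴳ 3 0 3)) 3 4 2
mrs-ℤ₃×ℤ₂³ = ZpS2-BySearch.mrs*-by-search 2 0 3
  ( ( ( (1F , [] , 1F ∷ 1F ∷ 1F ∷ []) ∷ (1F , [] , 1F ∷ 0F ∷ 0F ∷ []) ∷ (0F , [] , 0F ∷ 1F ∷ 1F ∷ []) ∷ (1F , [] , 0F ∷ 0F ∷ 0F ∷ []) ∷ [] )
    ∷ ( (0F , [] , 1F ∷ 1F ∷ 1F ∷ []) ∷ (1F , [] , 0F ∷ 0F ∷ 1F ∷ []) ∷ (0F , [] , 0F ∷ 1F ∷ 0F ∷ []) ∷ (2F , [] , 1F ∷ 0F ∷ 0F ∷ []) ∷ [] )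
    ∷ ( (2F , [] , 0F ∷ 0F ∷ 0F ∷ []) ∷ (1F , [] , 1F ∷ 0F ∷ 1F ∷ []) ∷ (0F , [] , 0F ∷ 0F ∷ 1F ∷ []) ∷ (0F , [] , 1F ∷ 0F ∷ 0F ∷ []) ∷ [] )
    ∷ [] )
  ∷ ( ( (0F , [] , 1F ∷ 1F ∷ 0F ∷ []) ∷ (2F , [] , 1F ∷ 1F ∷ 1F ∷ []) ∷ (2F , [] , 0F ∷ 1F ∷ 1F ∷ []) ∷ (2F , [] , 0F ∷ 1F ∷ 0F ∷ []) ∷ [] )
    ∷ ( (1F , [] , 0F ∷ 1F ∷ 1F ∷ []) ∷ (2F , [] , 1F ∷ 1F ∷ 0F ∷ []) ∷ (0F , [] , 1F ∷ 0F ∷ 1F ∷ []) ∷ (0F , [] , 0F ∷ 0F ∷ 0F ∷ []) ∷ [] )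
    ∷ ( (2F , [] , 1F ∷ 0F ∷ 1F ∷ []) ∷ (2F , [] , 0F ∷ 0F ∷ 1F ∷ []) ∷ (1F , [] , 1F ∷ 1F ∷ 0F ∷ []) ∷ (1F , [] , 0F ∷ 1F ∷ 0F ∷ []) ∷ [] )
    ∷ [] )
  ∷ [] )

Vec↔ : ∀ k n → Fin (k ^ n) ↔ Vec (Fin k) n
Vec↔ k zero    = mk↔ₛ′ (λ _ → []) (λ _ → zero) (λ { [] → refl }) (λ { 0F → refl })
Vec↔ k (suc n) = ↔-trans (*↔× {k}) (↔-trans (↔-refl ×-↔ Vec↔ k n) ∷↔)
  where
    ∷↔ : (Fin k × Vec (Fin k) n) ↔ Vec (Fin k) (suc n)
    ∷↔ = mk↔ₛ′ (λ (x , xs) → x ∷ xs) (λ { (x ∷ xs) → x , xs }) (λ { (x ∷ xs) → refl }) (λ (x , xs) → refl)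

ZpS2↔ : ∀ n α β → Fin (suc n * (4 ^ α * 2 ^ β)) ↔ ZpS2 (suc n) α β
ZpS2↔ n α β = ↔-trans (*↔× {suc n}) (↔-refl ×-↔ ↔-trans (*↔× {4 ^ α}) (Vec↔ 4 α ×-↔ Vec↔ 2 β))

module _ (n α β : ℕ) where

  private
    Zₚ×S₂ : ℕ → ℕ → ≡-AbelianGroup
    Zₚ×S₂ = ZpS2ᴳ (suc n)

  insert-ℤ₄² : Zₚ×S₂ α β ×ᴳ ℤ/ 4 ×ᴳ ℤ/ 4 ≅ ≡-AbelianGroup.abelianGroup (Zₚ×S₂ (2 + α) β)
  insert-ℤ₄² = ≅-from-↔ (Zₚ×S₂ α β ×ᴳ ℤ/ 4 ×ᴳ ℤ/ 4) (Zₚ×S₂ (2 + α) β)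
    (mk↔ₛ′ (λ ((a , u , v) , x , y) → a , x ∷ y ∷ u , v) (λ { (a , x ∷ y ∷ u , v) → (a , u , v) , x , y })
           (λ { (a , x ∷ y ∷ u , v) → refl }) (λ ((a , u , v) , x , y) → refl))
    (λ _ _ → refl)

  insert-ℤ₂² : Zₚ×S₂ α β ×ᴳ ℤ/ 2 ×ᴳ ℤ/ 2 ≅ ≡-AbelianGroup.abelianGroup (Zₚ×S₂ α (2 + β))
  insert-ℤ₂² = ≅-from-↔ (Zₚ×S₂ α β ×ᴳ ℤ/ 2 ×ᴳ ℤ/ 2) (Zₚ×S₂ α (2 + β))
    (mk↔ₛ′ (λ ((a , u , v) , x , y) → a , u , x ∷ y ∷ v) (λ { (a , u , x ∷ y ∷ v) → (a , u , v) , x , y })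
           (λ { (a , u , x ∷ y ∷ v) → refl }) (λ ((a , u , v) , x , y) → refl))
    (λ _ _ → refl)

MRS*-ZpS2 : ℕ → ℕ → ℕ → Set
MRS*-ZpS2 h α β = Σ ℕ (MRS* (≡-AbelianGroup.abelianGroup (ZpS2ᴳ (3 + h * 2) α β)) (3 + h * 2) 4)

via-core₂ : ∀ h {β z} → MRS* (≡-AbelianGroup.abelianGroup (ZpS2ᴳ 3 0 β)) 3 4 z → Core 2 (S₂ᴳ 0 β) →
            MRS*-ZpS2 h 0 β
via-core₂ zero    {z = z} M C = z , M
via-core₂ (suc h)         M C = Core.z C , core⇒mrs* C h

module _ (h : ℕ) where

  private
    p : ℕ
    p = 3 + h * 2

  extend-ℤ₄² : ∀ {α β} → MRS*-ZpS2 h α β → MRS*-ZpS2 h (2 + α) β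
  extend-ℤ₄² {α} {β} (z , M) = z * (4 * 4) ,
    mrs*-transport (insert-ℤ₄² (2 + h * 2) α β) (extend-by-square (ZpS2ᴳ p α β) (ℤ/ 4) {h} ↔-refl M)

  extend-ℤ₂² : ∀ {α β} → MRS*-ZpS2 h α β → MRS*-ZpS2 h α (2 + β)
  extend-ℤ₂² {α} {β} (z , M) = z * (2 * 2) ,
    mrs*-transport (insert-ℤ₂² (2 + h * 2) α β) (extend-by-square (ZpS2ᴳ p α β) (ℤ/ 2) {h} ↔-refl M)

  via-core₁ : ∀ {α β} → Core 1 (S₂ᴳ α β) → MRS*-ZpS2 h α β
  via-core₁ C = Core.z C , core⇒mrs* C h

  ZpS2-mrs* : ∀ α β → α + β ≥ 2 → MRS*-ZpS2 h α β
  ZpS2-mrs* 0 0 ()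
  ZpS2-mrs* 0 1 (s≤s ())
  ZpS2-mrs* 0 2 _ = via-core₂ h mrs-ℤ₃×ℤ₂² core-ℤ₂²
  ZpS2-mrs* 0 3 _ = via-core₂ h mrs-ℤ₃×ℤ₂³ core-ℤ₂³
  ZpS2-mrs* 0 (suc (suc (suc (suc β)))) _ = extend-ℤ₂² (ZpS2-mrs* 0 (suc (suc β)) (s≤s (s≤s z≤n)))
  ZpS2-mrs* 1 0 (s≤s ())
  ZpS2-mrs* 1 1 _ = via-core₁ core-ℤ₄×ℤ₂
  ZpS2-mrs* 1 2 _ = via-core₁ core-ℤ₄×ℤ₂²
  ZpS2-mrs* 1 (suc (suc (suc β))) _ = extend-ℤ₂² (ZpS2-mrs* 1 (suc β) (s≤s (s≤s z≤n)))
  ZpS2-mrs* 2 0 _ = via-core₁ core-ℤ₄²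
  ZpS2-mrs* 2 1 _ = via-core₁ core-ℤ₄²×ℤ₂
  ZpS2-mrs* 2 (suc (suc β)) _ = extend-ℤ₄² (ZpS2-mrs* 0 (suc (suc β)) (s≤s (s≤s z≤n)))
  ZpS2-mrs* 3 0 _ = via-core₁ core-ℤ₄³
  ZpS2-mrs* 3 (suc β) _ = extend-ℤ₄² (ZpS2-mrs* 1 (suc β) (s≤s (s≤s z≤n)))
  ZpS2-mrs* (suc (suc (suc (suc α)))) β _ = extend-ℤ₄² (ZpS2-mrs* (suc (suc α)) β (s≤s (s≤s z≤n)))

parity : ∀ n → (∃[ k ] n ≡ k * 2) ⊎ (∃[ k ] n ≡ 1 + k * 2)
parity zero          = inj₁ (0 , refl)
parity (suc zero)    = inj₂ (0 , refl)
parity (suc (suc n)) with parity n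
... | inj₁ (k , n≡2k)   = inj₁ (suc k , cong (2 +_) n≡2k)
... | inj₂ (k , n≡2k+1) = inj₂ (suc k , cong (2 +_) n≡2k+1)

odd-prime : ∀ {p} → Prime p → p ≢ 2 → ∃[ h ] p ≡ 3 + h * 2
odd-prime {p} p-prime p≢2 with parity p
... | inj₁ (k , p≡2k) with prime⇒irreducible p-prime (divides k p≡2k)
...   | inj₁ ()
...   | inj₂ 2≡p = contradiction (sym 2≡p) p≢2
odd-prime p-prime p≢2 | inj₂ (zero , refl)  = contradiction p-prime ¬prime[1]
odd-prime p-prime p≢2 | inj₂ (suc h , refl) = h , refl

IsoToZpS2⇒≅ : ∀ {c ℓ} {G : AbelianGroup c ℓ} {n α β} → IsoToZpS2 G (suc n) α β → ZpS2ᴳ (suc n) α β ≅ G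
IsoToZpS2⇒≅ iso = record { φ = φ ; homo = homo ; injective = injective ; surjective = surjective }
  where open IsoToZpS2 iso

ZpS2-mrs*-size : ∀ h {α β z} → MRS* (≡-AbelianGroup.abelianGroup (ZpS2ᴳ (3 + h * 2) α β)) (3 + h * 2) 4 z →
                 z * (4 * (3 + h * 2)) ≡ (3 + h * 2) * 4 ^ α * 2 ^ β
ZpS2-mrs*-size h {α} {β} {z} M = begin
  z * (4 * p)          ≡⟨ cong (z *_) (*-comm 4 p) ⟩
  z * (p * 4)          ≡⟨ mrs*-size (ZpS2ᴳ p α β) (ZpS2↔ (2 + h * 2) α β) M ⟩
  p * (4 ^ α * 2 ^ β)  ≡⟨ *-assoc p (4 ^ α) (2 ^ β) ⟨
  p * 4 ^ α * 2 ^ β    ∎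
  where
    open ≡-Reasoning
    p : ℕ
    p = 3 + h * 2

lemma3p5 : ∀ {c ℓ} (G : AbelianGroup c ℓ) (p α β : ℕ) →
    Prime p → p ≢ 2 → α + β ≥ 2 → IsoToZpS2 G p α β →
    Σ ℕ (λ z → (z * (4 * p) ≡ p * (4 ^ α) * (2 ^ β)) × MRS* G p 4 z)
lemma3p5 G p α β p-prime p≢2 α+β≥2 iso with odd-prime p-prime p≢2
... | h , refl = let z , M = ZpS2-mrs* h α β α+β≥2 in
  z , ZpS2-mrs*-size h M , mrs*-transport (IsoToZpS2⇒≅ iso) M
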